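{- Let $n\ge1$ and consider the procedure: (i) partition the edges of $G_{n,3}$ into $X,Y,Z$ by the initial partition; (ii) select a merging set $S$; (iii) consider the $4^n-1$ unit cubes with origins in $S$ (each of which is of type I); (iv) merge each of these cubes, one at a time. Then: (1) after step (i), $X$, $Y$, $Z$ each have exactly $4^n$ connected components (as spanning subgraphs, ignoring isolated-vertex issues: each component is a cycle), the components of $X$ being the subgraphs induced on the sets $Z_i=\{(x,y,z): z=i\}$, those of $Y$ on $X_i=\{(x,y,z): x=i\}$, and those of $Z$ on $Y_i=\{(x,y,z): y=i\}$, $0\le i<4^n$; (2) the cubes with origins in $S$ are pairwise vertex-disjoint; (3) throughout step (iv), for each fixed $i$ the vertices of $Z_i$ remain in a common component of $X$, the vertices of $X_i$ in a common component of $Y$, and the vertices of $Y_i$ in a common component of $Z$, and every merge operation reduces each of the numbers of components of $X$, $Y$ and $Z$ by $1$. In particular, after step (iv), $\{X,Y,Z\}$ is a Hamilton decomposition of $G_{n,3}$.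
   Context: $G_{n,3}$ is the Cartesian product of three copies of the cycle $C_{4^n}$: vertices $(x,y,z)$ with coordinates in $\mathbb{Z}/4^n\mathbb{Z}$, adjacent iff they differ in exactly one coordinate by $\pm1$. Initial partition: for each vertex $w=(x,y,z)$ with $x+y+z\equiv-1\pmod{4^n}$, the edge $w$–$(w+e_1)$ goes to $Z$, $w$–$(w+e_2)$ to $X$, $w$–$(w+e_3)$ to $Y$; for all other $w$, $w$–$(w+e_1)$ goes to $X$, $w$–$(w+e_2)$ to $Y$, $w$–$(w+e_3)$ to $Z$ ($e_i$ the unit vectors). A merging set is a set $S\subseteq\{0,\dots,4^n-1\}^3$ with $|S|=4^n-1$ whose members satisfy $x+y+z\equiv-1\pmod{4^n}$ and such that any two distinct members $(x,y,z),(x',y',z')$ have $x\ne x'$, $y\ne y'$, $z\ne z'$. For a vertex $v$, the unit cube with origin $v$ has vertices $v+(a,b,c)$, $a,b,c\in\{0,1\}$, written $abc$, and 12 edges. It is of type I if its edges are assigned as $X=\{000\text{–}010,\ 010\text{–}110,\ 001\text{–}101,\ 011\text{–}111\}$, $Y=\{000\text{–}001,\ 001\text{–}011,\ 100\text{–}110,\ 101\text{–}111\}$, $Z=\{000\text{–}100,\ 100\text{–}101,\ 010\text{–}011,\ 110\text{–}111\}$. Merging it means reassigning its edges as the type-II cube: $X=\{000\text{–}001,\ 010\text{–}110,\ 010\text{–}011,\ 101\text{–}111\}$, $Y=\{000\text{–}100,\ 001\text{–}101,\ 001\text{–}011,\ 110\text{–}111\}$, $Z=\{000\text{–}010,\ 011\text{–}111,\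 100\text{–}110,\ 100\text{–}101\}$. Components refer to connected components of the subgraphs formed by the edges of $X$ (resp. $Y$, $Z$). -}

module Defs where

open import Data.Nat using (ℕ; zero; suc; _+_; _∸_; _^_; _%_; NonZero)
open import Data.Nat.Properties using (m^n≢0)
open import Data.Nat.DivMod using (_mod_)
open import Data.Fin using (Fin; toℕ)
open import Data.Bool using (Bool; true; false; if_then_else_)
open import Data.Product using (Σ; _×_; _,_; ∃; proj₁; proj₂)
open import Data.List using (List; []; _∷_; length; take)
open import Relation.Binary.PropositionalEquality using (_≡_; _≢_)
open import Relation.Nullary using (¬_; yes; no)
open import Data.Product.Properties using (≡-dec)
import Data.Fin.Properties as FinP
open import Function using (Surjective)
open import Data.List.Relation.Unary.All using (All)
open import Data.List.Relation.Unary.AllPairs using (AllPairs)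

side : ℕ → ℕ
side n = 4 ^ n

module G (n : ℕ) where

  N : ℕ
  N = side n

  instance
    N-nonZero : NonZero N
    N-nonZero = m^n≢0 4 n

  -- The graph G_{n,3}: vertices (x,y,z) ∈ (ℤ/4ⁿℤ)³, coordinates as Fin (4 ^ n)



  Coord : Set
  Coord = Fin N

  Vertex : Set
  Vertex = Coord × Coord × Coord

  xc : Vertex → Coord
  xc (x , _ , _) = x

  yc : Vertex → Coord
  yc (_ , y , _) = y

  zc : Vertex → Coord
  zc (_ , _ , z) = z

  addC : Coord → ℕ → Coord
  addC x k = _mod_ (toℕ x + k) (N)

  data Dir : Set where
    e₁ e₂ e₃ : Dir

  move : Vertex → Dir → Vertex
  move (x , y , z) e₁ = (addC x 1 , y , z)
  move (x , y , z) e₂ = (x , addC y 1 , z)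
  move (x , y , z) e₃ = (x , y , addC z 1)

  back : Vertex → Dir → Vertex
  back (x , y , z) e₁ = (addC x (N ∸ 1) , y , z)
  back (x , y , z) e₂ = (x , addC y (N ∸ 1) , z)
  back (x , y , z) e₃ = (x , y , addC z (N ∸ 1))

  -- Every edge of G_{n,3} is  w – (w + e_d)  for a unique pair (w , d)
  -- (4ⁿ ≥ 4 for n ≥ 1, so this is a bijection with the edge set).
  -- An edge partition into X, Y, Z is a colouring of these pairs.

  data Colour : Set where
    cX cY cZ : Colour

  _≟C_ : (a b : Colour) → Relation.Nullary.Dec (a ≡ b)
  cX ≟C cX = yes Relation.Binary.PropositionalEquality.refl
  cY ≟C cY = yes Relation.Binary.PropositionalEquality.refl
  cZ ≟C cZ = yes Relation.Binary.PropositionalEquality.refl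
  cX ≟C cY = no λ ()
  cX ≟C cZ = no λ ()
  cY ≟C cX = no λ ()
  cY ≟C cZ = no λ ()
  cZ ≟C cX = no λ ()
  cZ ≟C cY = no λ ()

  _≟D_ : (a b : Dir) → Relation.Nullary.Dec (a ≡ b)
  e₁ ≟D e₁ = yes Relation.Binary.PropositionalEquality.refl
  e₂ ≟D e₂ = yes Relation.Binary.PropositionalEquality.refl
  e₃ ≟D e₃ = yes Relation.Binary.PropositionalEquality.refl
  e₁ ≟D e₂ = no λ ()
  e₁ ≟D e₃ = no λ ()
  e₂ ≟D e₁ = no λ ()
  e₂ ≟D e₃ = no λ ()
  e₃ ≟D e₁ = no λ ()
  e₃ ≟D e₂ = no λ ()

  _≟V_ : (u v : Vertex) → Relation.Nullary.Dec (u ≡ v)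
  _≟V_ = ≡-dec FinP._≟_ (≡-dec FinP._≟_ FinP._≟_)

  Partition : Set
  Partition = Vertex → Dir → Colour

  SumCond : Vertex → Set
  SumCond (x , y , z) = _%_ (toℕ x + toℕ y + toℕ z) (N) ≡ N ∸ 1

  isSpecial : Vertex → Bool
  isSpecial (x , y , z) with _%_ (toℕ x + toℕ y + toℕ z) (N) Data.Nat.≟ N ∸ 1
  ... | yes _ = true
  ... | no _ = false

  initial : Partition
  initial w d with isSpecial w
  initial w e₁ | true = cZ
  initial w e₂ | true = cX
  initial w e₃ | true = cY
  initial w e₁ | false = cX
  initial w e₂ | false = cY
  initial w e₃ | false = cZ

  data Path (P : Partition) (c : Colour) : Vertex → Vertex → Set where
    here : ∀ {v} → Path P c v v
    fwd  : ∀ {w v} (d : Dir) → P w d ≡ c → Path P c (move w d) v → Path P c w v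
    bwd  : ∀ {w v} (d : Dir) → P w d ≡ c → Path P c w v → Path P c (move w d) v

  -- The colour-c subgraph (spanning) has exactly k connected components:
  -- its components are in bijection with Fin k, i.e. there is a surjective
  -- labelling whose fibres are exactly the components.
  HasComponents : Partition → Colour → ℕ → Set
  HasComponents P c k =
    Σ (Vertex → Fin k) λ f →
      (∀ u v → Path P c u v → f u ≡ f v) ×
      (∀ u v → f u ≡ f v → Path P c u v) ×
      Surjective _≡_ _≡_ f

  count : Bool → ℕ
  count true = 1
  count false = 0

  isC : Colour → Colour → ℕ
  isC a b with a ≟C b
  ... | yes _ = 1
  ... | no _ = 0

  degree : Partition → Colour → Vertex → ℕ
  degree P c v =
    isC (P v e₁) c + isC (P v e₂) c + isC (P v e₃) c +
    isC (P (back v e₁) e₁) c + isC (P (back v e₂) e₂) c + isC (P (back v e₃) e₃) c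

  -- colour class c is a Hamilton cycle of G_{n,3}: spanning, connected, 2-regular
  HamiltonCycle : Partition → Colour → Set
  HamiltonCycle P c = HasComponents P c 1 × (∀ v → degree P c v ≡ 2)

  HamiltonDecomposition : Partition → Set
  HamiltonDecomposition P = HamiltonCycle P cX × HamiltonCycle P cY × HamiltonCycle P cZ

  corner : Vertex → Bool → Bool → Bool → Vertex
  corner (x , y , z) a b c =
    (addC x (count a) , addC y (count b) , addC z (count c))

  InCube : Vertex → Vertex → Set
  InCube v w = Σ Bool λ a → Σ Bool λ b → Σ Bool λ c → corner v a b c ≡ w

  -- A cube edge: base corner abc and direction d (edge abc – abc+e_d) with a colour
  record CubeEdge : Set where
    constructor ce
    field
      a b c : Bool
      dir : Dir
      col : Colour

  typeIEdges : List CubeEdge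
  typeIEdges =
    ce false false false e₂ cX ∷ ce false true false e₁ cX ∷ ce false false true e₁ cX ∷ ce false true true e₁ cX ∷
    ce false false false e₃ cY ∷ ce false false true e₂ cY ∷ ce true false false e₂ cY ∷ ce true false true e₂ cY ∷
    ce false false false e₁ cZ ∷ ce true false false e₃ cZ ∷ ce false true false e₃ cZ ∷ ce true true false e₃ cZ ∷ []

  typeIIEdges : List CubeEdge
  typeIIEdges =
    ce false false false e₃ cX ∷ ce false true false e₁ cX ∷ ce false true false e₃ cX ∷ ce true false true e₂ cX ∷
    ce false false false e₁ cY ∷ ce false false true e₁ cY ∷ ce false false true e₂ cY ∷ ce true true false e₃ cY ∷
    ce false false false e₂ cZ ∷ ce false true true e₁ cZ ∷ ce true false false e₂ cZ ∷ ce true false false e₃ cZ ∷ []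

  TypeI : Partition → Vertex → Set
  TypeI P v = All (λ e → P (corner v (CubeEdge.a e) (CubeEdge.b e) (CubeEdge.c e)) (CubeEdge.dir e) ≡ CubeEdge.col e) typeIEdges

  recolour : List CubeEdge → Vertex → Partition → Partition
  recolour [] v P w d = P w d
  recolour (ce a b c d' k ∷ es) v P w d with corner v a b c ≟V w | d' ≟D d
  ... | yes _ | yes _ = k
  ... | _ | _ = recolour es v P w d

  merge : Vertex → Partition → Partition
  merge v P = recolour typeIIEdges v P

  mergeAll : List Vertex → Partition → Partition
  mergeAll [] P = P
  mergeAll (v ∷ vs) P = mergeAll vs (merge v P)

  stateAfter : List Vertex → ℕ → Partition
  stateAfter S k = mergeAll (take k S) initial

  CoordsDiffer : Vertex → Vertex → Set
  CoordsDiffer (x , y , z) (x' , y' , z') = (x ≢ x') × (y ≢ y') × (z ≢ z')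

  -- S is given as a list enumerating the set (the list order is the order of merging)
  IsMergingSet : List Vertex → Set
  IsMergingSet S =
    (length S ≡ N ∸ 1) × All SumCond S × AllPairs CoordsDiffer S

-- The X-edges of a layer z = i of the initial partition form a single cycle, the snake,
-- which steps in x except at vertices with coordinate sum -1, where it steps in y. Rotating
-- the coordinates turns X into Z and Y into X, so the same holds for Y and Z with the layers
-- x = i and y = i. Cubes whose origins have coordinate sum -1 and pairwise distinct
-- coordinates are disjoint: a common corner would sit at complementary positions in the two
-- cubes and so have two different coordinate sums mod 4ⁿ. Merging such a cube cuts the snake
-- of its bottom layer once and that of its top layer twice, adds the chord 101–111 to the
-- top layer, and adds the X-edges 000–001 and 010–011 between the two layers. Hence every
-- layer stays connected in X (inducting upwards from a layer that is the bottom of no merged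
-- cube), and two layers lie in one X-component exactly when merged cubes link them. As the
-- cubes have distinct z-coordinates, k merges link the 4ⁿ layers into 4ⁿ - k classes.
-- Degrees are checked corner by corner on each cube.

{-# OPTIONS --safe #-}
module Submission where

open import Data.Bool using (Bool; true; false; not; if_then_else_)
import Data.Bool.Properties as Boolₚ
open import Data.Empty using (⊥-elim)
open import Data.Fin as Fin using (Fin; toℕ; punchOut; punchIn)
import Data.Fin.Properties as Finₚ
open import Data.List using (List; []; _∷_; length; lookup; map; take)
open import Data.List.Properties using (length-map; length-take)
open import Data.List.Membership.Propositional using (_∈_; _∉_; find; lose)
open import Data.List.Membership.Propositional.Properties using (∈-map⁺; ∈-map⁻; ∈-lookup)
open import Data.List.Relation.Unary.All as All using (All; []; _∷_)
import Data.List.Relation.Unary.All.Properties as Allₚ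
open import Data.List.Relation.Unary.AllPairs as AllPairs using (AllPairs; []; _∷_)
import Data.List.Relation.Unary.AllPairs.Properties as AllPairsₚ
open import Data.List.Relation.Unary.Any as Any using (Any; here; there)
open import Data.List.Relation.Unary.Any.Properties using (lookup-index)
open import Data.Maybe using (Maybe; just; nothing; fromMaybe)
import Data.Maybe
open import Data.Nat using (ℕ; zero; suc; _+_; _*_; _∸_; _%_; _/_; _≡ᵇ_; _≤_; _<_; _≤?_; _<?_; z≤n; s≤s; NonZero; >-nonZero⁻¹)
open import Data.Nat.Divisibility using (_∣_; divides)
open import Data.Nat.DivMod using (%-distribˡ-+; m%n%n≡m%n; n%n≡0; [m+n]%n≡m%n; [m+kn]%n≡m%n; m<n⇒m%n≡m; m%n<n; m≡m%n+[m/n]*n; m∣n⇒o%n%m≡o%m; m*n%n≡0)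
open import Data.Nat.Properties
open import Data.Nat.Tactic.RingSolver using (solve-∀)
open import Data.Product using (Σ; ∃; _×_; _,_; proj₁; proj₂)
open import Data.Product.Properties using (≡-dec)
open import Data.Sum using (_⊎_; inj₁; inj₂; [_,_]′)
open import Function using (_∘_; _⇔_; mk⇔; case_of_)
open import Relation.Binary.Construct.Closure.Equivalence as EqClosure using (EqClosure)
open import Relation.Binary.Construct.Closure.ReflexiveTransitive using (ε; _◅_)
import Relation.Binary.Construct.Closure.Symmetric as SymClosure
open import Relation.Binary.PropositionalEquality
open import Relation.Binary.Structures using (IsEquivalence)
open import Relation.Nullary using (¬_; Dec; yes; no; does)
open import Relation.Nullary.Decidable using (dec-true; dec-false)

open import Defs

module Congruence (m : ℕ) .{{_ : NonZero m}} where

  infix 4 _≋_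

  _≋_ : ℕ → ℕ → Set
  a ≋ b = a % m ≡ b % m

  ≋-refl : ∀ {a} → a ≋ a
  ≋-refl = refl

  ≋-sym : ∀ {a b} → a ≋ b → b ≋ a
  ≋-sym = sym

  ≋-trans : ∀ {a b c} → a ≋ b → b ≋ c → a ≋ c
  ≋-trans = trans

  ≡⇒≋ : ∀ {a b} → a ≡ b → a ≋ b
  ≡⇒≋ = cong (_% m)

  %-≋ : ∀ a → a % m ≋ a
  %-≋ a = m%n%n≡m%n a m

  +-cong-≋ : ∀ {a b c d} → a ≋ b → c ≋ d → a + c ≋ b + d
  +-cong-≋ {a} {b} {c} {d} p q = begin
    (a + c) % m          ≡⟨ %-distribˡ-+ a c m ⟩
    (a % m + c % m) % m  ≡⟨ cong₂ (λ u v → (u + v) % m) p q ⟩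
    (b % m + d % m) % m  ≡⟨ %-distribˡ-+ b d m ⟨
    (b + d) % m          ∎
    where open ≡-Reasoning

  +-congˡ-≋ : ∀ {a b} c → a ≋ b → c + a ≋ c + b
  +-congˡ-≋ c = +-cong-≋ (≋-refl {c})

  +-congʳ-≋ : ∀ {a b} c → a ≋ b → a + c ≋ b + c
  +-congʳ-≋ c p = +-cong-≋ p (≋-refl {c})

  m≋0 : m ≋ 0
  m≋0 = trans (n%n≡0 m) (sym (m<n⇒m%n≡m (>-nonZero⁻¹ m)))

  +m-≋ : ∀ a → a + m ≋ a
  +m-≋ a = [m+n]%n≡m%n a m

  +*m-≋ : ∀ a k → a + k * m ≋ a
  +*m-≋ a k = [m+kn]%n≡m%n a k m

  -- adding m ∸ c % m undoes adding c
  +-cancelʳ-≋ : ∀ {a b} c → a + c ≋ b + c → a ≋ b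
  +-cancelʳ-≋ {a} {b} c p = ≋-trans (≋-sym (undo a)) (≋-trans (+-congʳ-≋ c⁻ p) (undo b))
    where
    c⁻ = m ∸ c % m
    undo : ∀ x → x + c + c⁻ ≋ x
    undo x = begin
      (x + c + c⁻) % m        ≡⟨ ≡⇒≋ (+-assoc x c c⁻) ⟩
      (x + (c + c⁻)) % m      ≡⟨ +-congˡ-≋ x (+-congʳ-≋ c⁻ (≋-sym (%-≋ c))) ⟩
      (x + (c % m + c⁻)) % m  ≡⟨ ≡⇒≋ (cong (x +_) (m+[n∸m]≡n (<⇒≤ (m%n<n c m)))) ⟩
      (x + m) % m             ≡⟨ +m-≋ x ⟩
      x % m                   ∎
      where open ≡-Reasoning

  +-cancelˡ-≋ : ∀ {a b} c → c + a ≋ c + b → a ≋ b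
  +-cancelˡ-≋ {a} {b} c p = +-cancelʳ-≋ c (subst₂ _≋_ (+-comm c a) (+-comm c b) p)

  ≋⇒≡ : ∀ {a b} → a < m → b < m → a ≋ b → a ≡ b
  ≋⇒≡ a<m b<m p = trans (sym (m<n⇒m%n≡m a<m)) (trans p (m<n⇒m%n≡m b<m))

  ≢⇒≉ : ∀ {a b} → a < m → b < m → a ≢ b → ¬ a ≋ b
  ≢⇒≉ a<m b<m a≢b = a≢b ∘ ≋⇒≡ a<m b<m

length<⇒∃∉ : ∀ {m} (xs : List (Fin m)) → length xs < m → ∃ λ z → z ∉ xs
length<⇒∃∉ {m} xs short with Finₚ.all? (λ z → Any.any? (z Fin.≟_) xs)
... | no ¬all = Finₚ.¬∀⟶∃¬ m _ (λ z → Any.any? (z Fin.≟_) xs) ¬all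
... | yes all with Finₚ.pigeonhole short (λ z → Any.index (all z))
... | i , j , i<j , same = ⊥-elim (Finₚ.<⇒≢ i<j (begin
  i                           ≡⟨ lookup-index (all i) ⟩
  lookup xs (Any.index (all i)) ≡⟨ cong (lookup xs) same ⟩
  lookup xs (Any.index (all j)) ≡⟨ lookup-index (all j) ⟨
  j                           ∎))
  where open ≡-Reasoning

allPairs-∈ : ∀ {A : Set} {R : A → A → Set} {xs x y} → AllPairs R xs → x ∈ xs → y ∈ xs →
             x ≡ y ⊎ R x y ⊎ R y x
allPairs-∈ (_   ∷ _)   (here refl) (here refl) = inj₁ refl
allPairs-∈ (Rx ∷ _)   (here refl) (there y∈)  = inj₂ (inj₁ (All.lookup Rx y∈))
allPairs-∈ (Rx ∷ _)   (there x∈)  (here refl) = inj₂ (inj₂ (All.lookup Rx x∈))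
allPairs-∈ (_   ∷ Rxs) (there x∈)  (there y∈)  = allPairs-∈ Rxs x∈ y∈

allPairs-lookup : ∀ {A : Set} {R : A → A → Set} {xs} → AllPairs R xs → ∀ i j → i ≢ j →
                  R (lookup xs i) (lookup xs j) ⊎ R (lookup xs j) (lookup xs i)
allPairs-lookup (_ ∷ _)   Fin.zero    Fin.zero    i≢j = ⊥-elim (i≢j refl)
allPairs-lookup (Rx ∷ _)  Fin.zero    (Fin.suc j) _   = inj₁ (All.lookup Rx (∈-lookup j))
allPairs-lookup (Rx ∷ _)  (Fin.suc i) Fin.zero    _   = inj₂ (All.lookup Rx (∈-lookup i))
allPairs-lookup (_ ∷ Rxs) (Fin.suc i) (Fin.suc j) i≢j = allPairs-lookup Rxs i j (i≢j ∘ cong Fin.suc)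

allPairs-take-lookup : ∀ {A : Set} {R : A → A → Set} {xs} → AllPairs R xs → ∀ i →
                       All (λ x → R x (lookup xs i)) (take (toℕ i) xs)
allPairs-take-lookup (_ ∷ _)   Fin.zero    = []
allPairs-take-lookup (Rx ∷ Rxs) (Fin.suc i) = All.lookup Rx (∈-lookup i) ∷ allPairs-take-lookup Rxs i

∃-Bool? : ∀ {P : Bool → Set} → (∀ b → Dec (P b)) → Dec (Σ Bool P)
∃-Bool? P? with P? false | P? true
... | yes p  | _      = yes (false , p)
... | no _   | yes p  = yes (true , p)
... | no ¬pf | no ¬pt = no λ { (false , p) → ¬pf p ; (true , p) → ¬pt p }

module Identify {m : ℕ} (α β : Fin (suc m)) (α≢β : α ≢ β) where

  identify : Fin (suc m) → Fin m
  identify j with j Fin.≟ β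
  ... | yes _   = punchOut (α≢β ∘ sym)
  ... | no j≢β = punchOut (j≢β ∘ sym)

  identify-αβ : identify α ≡ identify β
  identify-αβ with α Fin.≟ β | β Fin.≟ β
  ... | yes α≡β | _      = ⊥-elim (α≢β α≡β)
  ... | no _    | yes _  = Finₚ.punchOut-cong β refl
  ... | no _    | no β≢β = ⊥-elim (β≢β refl)

  identify-injective : ∀ j k → identify j ≡ identify k →
                       j ≡ k ⊎ (j ≡ β × k ≡ α) ⊎ (j ≡ α × k ≡ β)
  identify-injective j k eq with j Fin.≟ β | k Fin.≟ β
  ... | yes j≡β | yes k≡β = inj₁ (trans j≡β (sym k≡β))
  ... | yes j≡β | no _    = inj₂ (inj₁ (j≡β , sym (Finₚ.punchOut-injective {i = β} _ _ eq)))
  ... | no _    | yes k≡β = inj₂ (inj₂ (Finₚ.punchOut-injective {i = β} _ _ eq , k≡β))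
  ... | no _    | no _    = inj₁ (Finₚ.punchOut-injective {i = β} _ _ eq)

  identify-surjective : ∀ k → ∃ λ j → identify j ≡ k
  identify-surjective k = punchIn β k , identify-punchIn
    where
    identify-punchIn : identify (punchIn β k) ≡ k
    identify-punchIn with punchIn β k Fin.≟ β
    ... | yes eq = ⊥-elim (Finₚ.punchInᵢ≢i β k eq)
    ... | no _   = trans (Finₚ.punchOut-cong β refl) (Finₚ.punchOut-punchIn β)

module Grid (n : ℕ) (1≤n : 1 ≤ n) where

  open G n
  open Congruence N

  4≤N : 4 ≤ N
  4≤N = ^-monoʳ-≤ 4 1≤n

  <4⇒<N : ∀ {k} → k < 4 → k < N
  <4⇒<N k<4 = ≤-trans k<4 4≤N

  suc[N∸1]≡N : suc (N ∸ 1) ≡ N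
  suc[N∸1]≡N = m+[n∸m]≡n {1} (<4⇒<N (s≤s z≤n))

  N∸1+1≡N : N ∸ 1 + 1 ≡ N
  N∸1+1≡N = trans (+-comm (N ∸ 1) 1) suc[N∸1]≡N

  N∸1<N : N ∸ 1 < N
  N∸1<N = subst (N ∸ 1 <_) suc[N∸1]≡N ≤-refl

  3≤N∸1 : 3 ≤ N ∸ 1
  3≤N∸1 = ∸-monoˡ-≤ 1 4≤N

  N∸1%N : (N ∸ 1) % N ≡ N ∸ 1
  N∸1%N = m<n⇒m%n≡m N∸1<N

  toℕ-addC : ∀ x k → toℕ (addC x k) ≡ (toℕ x + k) % N
  toℕ-addC x k = Finₚ.toℕ-fromℕ< (m%n<n (toℕ x + k) N)

  toℕ-addC-≋ : ∀ x k → toℕ (addC x k) ≋ toℕ x + k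
  toℕ-addC-≋ x k = trans (cong (_% N) (toℕ-addC x k)) (%-≋ (toℕ x + k))

  toℕ-≋-injective : ∀ {x y : Coord} → toℕ x ≋ toℕ y → x ≡ y
  toℕ-≋-injective {x} {y} = Finₚ.toℕ-injective ∘ ≋⇒≡ (Finₚ.toℕ<n x) (Finₚ.toℕ<n y)

  addC-identityʳ : ∀ x → addC x 0 ≡ x
  addC-identityʳ x = toℕ-≋-injective (≋-trans (toℕ-addC-≋ x 0) (≡⇒≋ (+-identityʳ (toℕ x))))

  addC-assoc : ∀ x a b → addC (addC x a) b ≡ addC x (a + b)
  addC-assoc x a b = toℕ-≋-injective (begin
    toℕ (addC (addC x a) b) % N  ≡⟨ toℕ-addC-≋ (addC x a) b ⟩
    (toℕ (addC x a) + b) % N     ≡⟨ +-congʳ-≋ b (toℕ-addC-≋ x a) ⟩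
    (toℕ x + a + b) % N          ≡⟨ ≡⇒≋ (+-assoc (toℕ x) a b) ⟩
    (toℕ x + (a + b)) % N        ≡⟨ toℕ-addC-≋ x (a + b) ⟨
    toℕ (addC x (a + b)) % N     ∎)
    where open ≡-Reasoning

  addC-cycle : ∀ x {a b} → a + b ≡ N → addC (addC x a) b ≡ x
  addC-cycle x {a} {b} a+b≡N = trans (addC-assoc x a b) (toℕ-≋-injective (begin
    toℕ (addC x (a + b)) % N  ≡⟨ toℕ-addC-≋ x (a + b) ⟩
    (toℕ x + (a + b)) % N     ≡⟨ ≡⇒≋ (cong (toℕ x +_) a+b≡N) ⟩
    (toℕ x + N) % N           ≡⟨ +m-≋ (toℕ x) ⟩
    toℕ x % N                 ∎))
    where open ≡-Reasoning

  addC-cancelˡ : ∀ x {a b} → addC x a ≡ addC x b → a ≋ b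
  addC-cancelˡ x {a} {b} eq = +-cancelˡ-≋ (toℕ x)
    (≋-trans (≋-sym (toℕ-addC-≋ x a)) (≋-trans (≡⇒≋ (cong toℕ eq)) (toℕ-addC-≋ x b)))

  addC-cancelʳ : ∀ {x x'} k → addC x k ≡ addC x' k → x ≡ x'
  addC-cancelʳ {x} {x'} k eq = toℕ-≋-injective (+-cancelʳ-≋ k
    (≋-trans (≋-sym (toℕ-addC-≋ x k)) (≋-trans (≡⇒≋ (cong toℕ eq)) (toℕ-addC-≋ x' k))))

  count≤1 : ∀ a → count a ≤ 1
  count≤1 false = z≤n
  count≤1 true  = s≤s z≤n

  addC-1-back : ∀ x → addC (addC x 1) (N ∸ 1) ≡ addC x 0
  addC-1-back x = trans (addC-cycle x suc[N∸1]≡N) (sym (addC-identityʳ x))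

  addC-0-back≢ : ∀ x a → addC (addC x 0) (N ∸ 1) ≢ addC x (count a)
  addC-0-back≢ x a eq = ≢⇒≉ N∸1<N (<4⇒<N (≤-trans count<3 (n≤1+n 3))) (<⇒≢ (<-≤-trans count<3 3≤N∸1) ∘ sym)
                                 (addC-cancelˡ x (trans (sym (addC-assoc x 0 (N ∸ 1))) eq))
    where
    count<3 : count a < 3
    count<3 = s≤s (≤-trans (count≤1 a) (s≤s z≤n))

  ,-injective : ∀ {x x' y y' z z' : Coord} → (x , y , z) ≡ (x' , y' , z') → x ≡ x' × y ≡ y' × z ≡ z'
  ,-injective refl = refl , refl , refl

  move-back : ∀ w d → move (back w d) d ≡ w
  move-back (x , y , z) e₁ = cong (_, y , z) (addC-cycle x N∸1+1≡N)
  move-back (x , y , z) e₂ = cong (λ t → x , t , z) (addC-cycle y N∸1+1≡N)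
  move-back (x , y , z) e₃ = cong (λ t → x , y , t) (addC-cycle z N∸1+1≡N)

  -- Coordinate sums and special vertices

  σ : Vertex → ℕ
  σ (x , y , z) = toℕ x + toℕ y + toℕ z

  σ-addCˣ : ∀ x y z k → σ (addC x k , y , z) ≋ σ (x , y , z) + k
  σ-addCˣ x y z k = ≋-trans (+-congʳ-≋ (toℕ z) (+-congʳ-≋ (toℕ y) (toℕ-addC-≋ x k)))
                            (≡⇒≋ (shuffle (toℕ x) (toℕ y) (toℕ z) k))
    where
    shuffle : ∀ x y z k → x + k + y + z ≡ x + y + z + k
    shuffle = solve-∀

  σ-addCʸ : ∀ x y z k → σ (x , addC y k , z) ≋ σ (x , y , z) + k
  σ-addCʸ x y z k = ≋-trans (+-congʳ-≋ (toℕ z) (+-congˡ-≋ (toℕ x) (toℕ-addC-≋ y k)))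
                            (≡⇒≋ (shuffle (toℕ x) (toℕ y) (toℕ z) k))
    where
    shuffle : ∀ x y z k → x + (y + k) + z ≡ x + y + z + k
    shuffle = solve-∀

  σ-addCᶻ : ∀ x y z k → σ (x , y , addC z k) ≋ σ (x , y , z) + k
  σ-addCᶻ x y z k = ≋-trans (+-congˡ-≋ (toℕ x + toℕ y) (toℕ-addC-≋ z k))
                            (≡⇒≋ (sym (+-assoc (toℕ x + toℕ y) (toℕ z) k)))

  σ-move : ∀ w d → σ (move w d) ≋ σ w + 1
  σ-move (x , y , z) e₁ = σ-addCˣ x y z 1
  σ-move (x , y , z) e₂ = σ-addCʸ x y z 1
  σ-move (x , y , z) e₃ = σ-addCᶻ x y z 1

  σ-back : ∀ w d → σ (back w d) ≋ σ w + (N ∸ 1)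
  σ-back (x , y , z) e₁ = σ-addCˣ x y z (N ∸ 1)
  σ-back (x , y , z) e₂ = σ-addCʸ x y z (N ∸ 1)
  σ-back (x , y , z) e₃ = σ-addCᶻ x y z (N ∸ 1)

  special⇒≋ : ∀ w → isSpecial w ≡ true → σ w ≋ N ∸ 1
  special⇒≋ (x , y , z) eq with (toℕ x + toℕ y + toℕ z) % N ≟ N ∸ 1
  special⇒≋ (x , y , z) eq | yes σ≡ = trans σ≡ (sym N∸1%N)
  special⇒≋ (x , y , z) () | no _

  ≋⇒special : ∀ w → σ w ≋ N ∸ 1 → isSpecial w ≡ true
  ≋⇒special (x , y , z) σ≋ with (toℕ x + toℕ y + toℕ z) % N ≟ N ∸ 1
  ... | yes _  = refl
  ... | no σ≢ = ⊥-elim (σ≢ (trans σ≋ N∸1%N))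

  isSpecial-≋ : ∀ w j → j < N → σ w ≋ (N ∸ 1) + j → isSpecial w ≡ (j ≡ᵇ 0)
  isSpecial-≋ w zero    _   σ≋ = ≋⇒special w (≋-trans σ≋ (≡⇒≋ (+-identityʳ (N ∸ 1))))
  isSpecial-≋ w (suc j) j<N σ≋ with isSpecial w in eq
  ... | false = refl
  ... | true  = ⊥-elim (≢⇒≉ (<4⇒<N (s≤s z≤n)) j<N (λ ()) (+-cancelˡ-≋ (N ∸ 1)
                  (≋-trans (≡⇒≋ (+-identityʳ (N ∸ 1))) (≋-trans (≋-sym (special⇒≋ w eq)) σ≋))))

  isSpecial-cong : ∀ w w' → σ w ≋ σ w' → isSpecial w ≡ isSpecial w'
  isSpecial-cong w w' σ≋ with isSpecial w in eq | isSpecial w' in eq'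
  ... | true  | true  = refl
  ... | false | false = refl
  ... | true  | false = trans (sym (≋⇒special w' (≋-trans (≋-sym σ≋) (special⇒≋ w eq)))) eq'
  ... | false | true  = trans (sym eq) (≋⇒special w (≋-trans σ≋ (special⇒≋ w' eq')))

  initialColour : Bool → Dir → Colour
  initialColour true  e₁ = cZ
  initialColour true  e₂ = cX
  initialColour true  e₃ = cY
  initialColour false e₁ = cX
  initialColour false e₂ = cY
  initialColour false e₃ = cZ

  initial≡initialColour : ∀ w d → initial w d ≡ initialColour (isSpecial w) d
  initial≡initialColour w d with isSpecial w
  initial≡initialColour w e₁ | true  = refl
  initial≡initialColour w e₂ | true  = refl
  initial≡initialColour w e₃ | true  = refl
  initial≡initialColour w e₁ | false = refl
  initial≡initialColour w e₂ | false = refl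
  initial≡initialColour w e₃ | false = refl

  N∸1≡ᵇ0≡false : (N ∸ 1 ≡ᵇ 0) ≡ false
  N∸1≡ᵇ0≡false with N ∸ 1 | 3≤N∸1
  ... | suc _ | _ = refl

  predMod : ℕ → ℕ
  predMod zero    = N ∸ 1
  predMod (suc k) = k

  predMod-≋ : ∀ k → (N ∸ 1) + k ≋ predMod k
  predMod-≋ zero    = ≡⇒≋ (+-identityʳ (N ∸ 1))
  predMod-≋ (suc k) = ≋-trans (≡⇒≋ (trans (+-suc (N ∸ 1) k) (trans (cong (_+ k) suc[N∸1]≡N) (+-comm N k)))) (+m-≋ k)

  predMod<N : ∀ k → k ≤ 3 → predMod k < N
  predMod<N zero    _         = N∸1<N
  predMod<N (suc k) (s≤s k≤2) = <4⇒<N (s≤s (≤-trans k≤2 (n≤1+n 2)))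

  special⇒back-nonspecial : ∀ v → isSpecial v ≡ true → isSpecial (back v e₁) ≡ false
  special⇒back-nonspecial v v-special =
    trans (isSpecial-≋ (back v e₁) (N ∸ 1) N∸1<N (≋-trans (σ-back v e₁) (+-congʳ-≋ (N ∸ 1) (special⇒≋ v v-special))))
          N∸1≡ᵇ0≡false

  initial-back : ∀ v d → initial (back v d) d ≡ initialColour (isSpecial (back v e₁)) d
  initial-back v d = trans (initial≡initialColour (back v d) d) (cong (λ s → initialColour s d)
    (isSpecial-cong (back v d) (back v e₁) (≋-trans (σ-back v d) (≋-sym (σ-back v e₁)))))

  weight : Bool → Bool → Bool → ℕ
  weight a b c = count a + count b + count c

  weight≤3 : ∀ a b c → weight a b c ≤ 3
  weight≤3 a b c = +-mono-≤ (+-mono-≤ (count≤1 a) (count≤1 b)) (count≤1 c)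

  weight<N : ∀ a b c → weight a b c < N
  weight<N a b c = <4⇒<N (s≤s (weight≤3 a b c))

  σ-corner : ∀ {o} → SumCond o → ∀ a b c → σ (corner o a b c) ≋ (N ∸ 1) + weight a b c
  σ-corner {x , y , z} sc a b c = begin
    σ (corner (x , y , z) a b c) % N
      ≡⟨ +-cong-≋ (+-cong-≋ (toℕ-addC-≋ x _) (toℕ-addC-≋ y _)) (toℕ-addC-≋ z _) ⟩
    (toℕ x + count a + (toℕ y + count b) + (toℕ z + count c)) % N
      ≡⟨ ≡⇒≋ (shuffle (toℕ x) (toℕ y) (toℕ z) (count a) (count b) (count c)) ⟩
    (σ (x , y , z) + weight a b c) % N
      ≡⟨ +-congʳ-≋ (weight a b c) (trans sc (sym N∸1%N)) ⟩
    ((N ∸ 1) + weight a b c) % N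
      ∎
    where
    open ≡-Reasoning
    shuffle : ∀ x y z a b c → x + a + (y + b) + (z + c) ≡ x + y + z + (a + b + c)
    shuffle = solve-∀

  isSpecial-corner : ∀ {o} → SumCond o → ∀ a b c → isSpecial (corner o a b c) ≡ (weight a b c ≡ᵇ 0)
  isSpecial-corner sc a b c = isSpecial-≋ _ (weight a b c) (weight<N a b c) (σ-corner sc a b c)

  initial-corner : ∀ {o} → SumCond o → ∀ a b c d →
                   initial (corner o a b c) d ≡ initialColour (weight a b c ≡ᵇ 0) d
  initial-corner sc a b c d =
    trans (initial≡initialColour _ d) (cong (λ s → initialColour s d) (isSpecial-corner sc a b c))

  isSpecial-back-corner : ∀ {o} → SumCond o → ∀ a b c d →
                          isSpecial (back (corner o a b c) d) ≡ (weight a b c ≡ᵇ 1)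
  isSpecial-back-corner sc a b c d =
    trans (isSpecial-≋ _ (predMod w) (predMod<N w (weight≤3 a b c)) σ≋) (predMod≡ᵇ0 w (weight≤3 a b c))
    where
    w = weight a b c
    swap : ∀ m w → m + w + m ≡ m + (m + w)
    swap = solve-∀
    σ≋ : σ (back (corner _ a b c) d) ≋ (N ∸ 1) + predMod w
    σ≋ = begin
      σ (back (corner _ a b c) d) % N  ≡⟨ σ-back (corner _ a b c) d ⟩
      (σ (corner _ a b c) + (N ∸ 1)) % N ≡⟨ +-congʳ-≋ (N ∸ 1) (σ-corner sc a b c) ⟩
      ((N ∸ 1) + w + (N ∸ 1)) % N      ≡⟨ ≡⇒≋ (swap (N ∸ 1) w) ⟩
      ((N ∸ 1) + ((N ∸ 1) + w)) % N    ≡⟨ +-congˡ-≋ (N ∸ 1) (predMod-≋ w) ⟩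
      ((N ∸ 1) + predMod w) % N        ∎
      where open ≡-Reasoning
    predMod≡ᵇ0 : ∀ k → k ≤ 3 → (predMod k ≡ᵇ 0) ≡ (k ≡ᵇ 1)
    predMod≡ᵇ0 0 _ = N∸1≡ᵇ0≡false
    predMod≡ᵇ0 1 _ = refl
    predMod≡ᵇ0 2 _ = refl
    predMod≡ᵇ0 3 _ = refl
    predMod≡ᵇ0 (suc (suc (suc (suc _)))) (s≤s (s≤s (s≤s ())))

  count-injective : ∀ a b → count a ≋ count b → a ≡ b
  count-injective false false _ = refl
  count-injective true  true  _ = refl
  count-injective false true  p = ⊥-elim (≢⇒≉ (<4⇒<N (s≤s z≤n)) (<4⇒<N (s≤s (s≤s z≤n))) (λ ()) p)
  count-injective true  false p = ⊥-elim (≢⇒≉ (<4⇒<N (s≤s (s≤s z≤n))) (<4⇒<N (s≤s z≤n)) (λ ()) p)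

  corner-injective : ∀ o {a b c a' b' c'} → corner o a b c ≡ corner o a' b' c' → a ≡ a' × b ≡ b' × c ≡ c'
  corner-injective (x , y , z) {a} {b} {c} {a'} {b'} {c'} eq with ,-injective eq
  ... | eqx , eqy , eqz = count-injective a a' (addC-cancelˡ x eqx) ,
                          count-injective b b' (addC-cancelˡ y eqy) ,
                          count-injective c c' (addC-cancelˡ z eqz)

  Bits : Set
  Bits = Bool × Bool × Bool

  corner′ : Vertex → Bits → Vertex
  corner′ o (a , b , c) = corner o a b c

  bit : Dir → Bool → Bool → Bool → Bool
  bit e₁ a b c = a
  bit e₂ a b c = b
  bit e₃ a b c = c

  setBit : Dir → Bool → Bool → Bool → Bool → Bits
  setBit e₁ v a b c = v , b , c
  setBit e₂ v a b c = a , v , c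
  setBit e₃ v a b c = a , b , v

  corner-move : ∀ o a b c d → bit d a b c ≡ false → move (corner o a b c) d ≡ corner′ o (setBit d true a b c)
  corner-move (x , y , z) false b c e₁ refl = cong (_, _) (addC-assoc x 0 1)
  corner-move (x , y , z) a false c e₂ refl = cong (λ t → _ , t , _) (addC-assoc y 0 1)
  corner-move (x , y , z) a b false e₃ refl = cong (λ t → _ , _ , t) (addC-assoc z 0 1)

  corner-move-inCube : ∀ o a b c d → bit d a b c ≡ false → InCube o (move (corner o a b c) d)
  corner-move-inCube o a b c d bit≡ with setBit d true a b c | corner-move o a b c d bit≡
  ... | a' , b' , c' | eq = a' , b' , c' , sym eq

  corner-back : ∀ o a b c d → bit d a b c ≡ true → back (corner o a b c) d ≡ corner′ o (setBit d false a b c)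
  corner-back (x , y , z) true b c e₁ refl = cong (_, _) (addC-1-back x)
  corner-back (x , y , z) a true c e₂ refl = cong (λ t → _ , t , _) (addC-1-back y)
  corner-back (x , y , z) a b true e₃ refl = cong (λ t → _ , _ , t) (addC-1-back z)

  back-corner-outside : ∀ o a b c d → bit d a b c ≡ false → ∀ a' b' c' → back (corner o a b c) d ≢ corner o a' b' c'
  back-corner-outside (x , y , z) false b c e₁ refl a' b' c' eq = addC-0-back≢ x a' (proj₁ (,-injective eq))
  back-corner-outside (x , y , z) a false c e₂ refl a' b' c' eq = addC-0-back≢ y b' (proj₁ (proj₂ (,-injective eq)))
  back-corner-outside (x , y , z) a b false e₃ refl a' b' c' eq = addC-0-back≢ z c' (proj₂ (proj₂ (,-injective eq)))

  _≟key_ : (k k' : Bits × Dir) → Dec (k ≡ k')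
  _≟key_ = ≡-dec (≡-dec Boolₚ._≟_ (≡-dec Boolₚ._≟_ Boolₚ._≟_)) _≟D_

  lookupBits : List CubeEdge → Bool → Bool → Bool → Dir → Maybe Colour
  lookupBits []                    a b c d = nothing
  lookupBits (ce a' b' c' d' k ∷ es) a b c d with ((a' , b' , c') , d') ≟key ((a , b , c) , d)
  ... | yes _ = just k
  ... | no _  = lookupBits es a b c d

  typeII : Bool → Bool → Bool → Dir → Maybe Colour
  typeII = lookupBits typeIIEdges

  recolour-corner : ∀ es o P a b c d →
                    recolour es o P (corner o a b c) d ≡ fromMaybe (P (corner o a b c) d) (lookupBits es a b c d)
  recolour-corner []                      o P a b c d = refl
  recolour-corner (ce a' b' c' d' k ∷ es) o P a b c d
    with corner o a' b' c' ≟V corner o a b c | d' ≟D d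
       | ((a' , b' , c') , d') ≟key ((a , b , c) , d)
  ... | yes _  | yes _    | yes _ = refl
  ... | yes eq | yes refl | no ne with corner-injective o eq
  ...   | refl , refl , refl = ⊥-elim (ne refl)
  recolour-corner (ce a' b' c' d' k ∷ es) o P a b c d | _ | no d≢ | yes refl = ⊥-elim (d≢ refl)
  recolour-corner (ce a' b' c' d' k ∷ es) o P a b c d | no c≢ | _ | yes refl = ⊥-elim (c≢ refl)
  recolour-corner (ce a' b' c' d' k ∷ es) o P a b c d | yes _ | no _ | no _ = recolour-corner es o P a b c d
  recolour-corner (ce a' b' c' d' k ∷ es) o P a b c d | no _  | _    | no _ = recolour-corner es o P a b c d

  recolour-outside : ∀ es o P w d → ¬ InCube o w → recolour es o P w d ≡ P w d
  recolour-outside []                      o P w d w∉ = refl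
  recolour-outside (ce a' b' c' d' k ∷ es) o P w d w∉ with corner o a' b' c' ≟V w | d' ≟D d
  ... | yes eq | yes _ = ⊥-elim (w∉ (a' , b' , c' , eq))
  ... | yes _  | no _  = recolour-outside es o P w d w∉
  ... | no _   | _     = recolour-outside es o P w d w∉

  inCube? : ∀ o w → Dec (InCube o w)
  inCube? o w = ∃-Bool? λ a → ∃-Bool? λ b → ∃-Bool? λ c → corner o a b c ≟V w

  CubesDisjoint : Vertex → Vertex → Set
  CubesDisjoint o o' = ∀ w → InCube o w → ¬ InCube o' w

  InSomeCube : List Vertex → Vertex → Set
  InSomeCube L w = Any (λ o → InCube o w) L

  mergeAll-outside : ∀ L P w d → ¬ InSomeCube L w → mergeAll L P w d ≡ P w d
  mergeAll-outside []      P w d w∉ = refl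
  mergeAll-outside (o ∷ L) P w d w∉ =
    trans (mergeAll-outside L (merge o P) w d (w∉ ∘ there)) (recolour-outside typeIIEdges o P w d (w∉ ∘ here))

  mergeAll-corner : ∀ {L} P → AllPairs CubesDisjoint L → ∀ {o} → o ∈ L → ∀ a b c d →
                    mergeAll L P (corner o a b c) d ≡ fromMaybe (P (corner o a b c) d) (typeII a b c d)
  mergeAll-corner {o ∷ L} P (o#L ∷ _) (here refl) a b c d =
    trans (mergeAll-outside L (merge o P) _ d outside) (recolour-corner typeIIEdges o P a b c d)
    where
    outside : ¬ InSomeCube L (corner o a b c)
    outside any with find any
    ... | o' , o'∈L , inCube' = All.lookup o#L o'∈L _ (a , b , c , refl) inCube'
  mergeAll-corner {o' ∷ L} P (o'#L ∷ disjoint) {o} (there o∈L) a b c d =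
    trans (mergeAll-corner (merge o' P) disjoint o∈L a b c d)
          (cong (λ k → fromMaybe k (typeII a b c d)) (recolour-outside typeIIEdges o' P _ d outside))
    where
    outside : ¬ InCube o' (corner o a b c)
    outside inCube' = All.lookup o'#L o∈L _ inCube' (a , b , c , refl)

  bit-flip : ∀ {x x' : Coord} {a a'} → x ≢ x' → addC x (count a) ≡ addC x' (count a') → a' ≡ not a
  bit-flip {a = false} {false} x≢x' eq = ⊥-elim (x≢x' (addC-cancelʳ 0 eq))
  bit-flip {a = true}  {true}  x≢x' eq = ⊥-elim (x≢x' (addC-cancelʳ 1 eq))
  bit-flip {a = false} {true}  _    _  = refl
  bit-flip {a = true}  {false} _    _  = refl

  weight≢weight-not : ∀ a b c → weight a b c ≢ weight (not a) (not b) (not c)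
  weight≢weight-not false false false ()
  weight≢weight-not false false true  ()
  weight≢weight-not false true  false ()
  weight≢weight-not false true  true  ()
  weight≢weight-not true  false false ()
  weight≢weight-not true  false true  ()
  weight≢weight-not true  true  false ()
  weight≢weight-not true  true  true  ()

  -- A shared corner would have complementary bits in the two cubes, so its coordinate
  -- sum would be both -1 + k and -1 + (3 - k).
  cubes-disjoint : ∀ {o o'} → SumCond o → SumCond o' → CoordsDiffer o o' → CubesDisjoint o o'
  cubes-disjoint {o} {o'} sc sc' (x≢ , y≢ , z≢) w (a , b , c , refl) (a' , b' , c' , eq)
    with ,-injective eq
  ... | eqx , eqy , eqz
    with bit-flip {a = a'} (x≢ ∘ sym) eqx | bit-flip {a = b'} (y≢ ∘ sym) eqy | bit-flip {a = c'} (z≢ ∘ sym) eqz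
  ... | refl | refl | refl =
    ≢⇒≉ (weight<N a' b' c') (weight<N (not a') (not b') (not c')) (weight≢weight-not a' b' c')
        (+-cancelˡ-≋ (N ∸ 1) (≋-trans (≋-sym σ-as-corner-of-o') (σ-corner sc (not a') (not b') (not c'))))
    where
    σ-as-corner-of-o' : σ (corner o (not a') (not b') (not c')) ≋ (N ∸ 1) + weight a' b' c'
    σ-as-corner-of-o' = subst (λ v → σ v ≋ (N ∸ 1) + weight a' b' c') eq (σ-corner sc' a' b' c')

  IsPartialMergingSet : List Vertex → Set
  IsPartialMergingSet L = All SumCond L × AllPairs CoordsDiffer L

  cubes-allPairs-disjoint : ∀ {L} → IsPartialMergingSet L → AllPairs CubesDisjoint L
  cubes-allPairs-disjoint ([]       , [])        = []
  cubes-allPairs-disjoint (sc ∷ scs , cd ∷ cds) =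
    All.zipWith (λ (sc' , cd') → cubes-disjoint sc sc' cd') (scs , cd) ∷ cubes-allPairs-disjoint (scs , cds)

  merged : List Vertex → Partition
  merged L = mergeAll L initial

  cubeColour : Bool → Bool → Bool → Dir → Colour
  cubeColour a b c d = fromMaybe (initialColour (weight a b c ≡ᵇ 0) d) (typeII a b c d)

  merged-corner : ∀ {L} → IsPartialMergingSet L → ∀ {o} → o ∈ L → ∀ a b c d →
                  merged L (corner o a b c) d ≡ cubeColour a b c d
  merged-corner pms@(scs , _) o∈L a b c d =
    trans (mergeAll-corner initial (cubes-allPairs-disjoint pms) o∈L a b c d)
          (cong (λ k → fromMaybe k (typeII a b c d)) (initial-corner (All.lookup scs o∈L) a b c d))

  merged-outside : ∀ L w d → ¬ InSomeCube L w → merged L w d ≡ initial w d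
  merged-outside L = mergeAll-outside L initial

  typeII-outward : ∀ a b c d → bit d a b c ≡ true → typeII a b c d ≡ nothing
  typeII-outward true  false false e₁ refl = refl
  typeII-outward true  false true  e₁ refl = refl
  typeII-outward true  true  false e₁ refl = refl
  typeII-outward true  true  true  e₁ refl = refl
  typeII-outward false true  false e₂ refl = refl
  typeII-outward false true  true  e₂ refl = refl
  typeII-outward true  true  false e₂ refl = refl
  typeII-outward true  true  true  e₂ refl = refl
  typeII-outward false false true  e₃ refl = refl
  typeII-outward false true  true  e₃ refl = refl
  typeII-outward true  false true  e₃ refl = refl
  typeII-outward true  true  true  e₃ refl = refl

  EdgeInCube : Vertex → Vertex → Dir → Set
  EdgeInCube o w d = InCube o w × InCube o (move w d)

  merged-uncovered : ∀ {L} → IsPartialMergingSet L → ∀ w d → (∀ {o} → o ∈ L → ¬ EdgeInCube o w d) →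
                     merged L w d ≡ initial w d
  merged-uncovered {L} pms w d uncovered with Any.any? (λ o → inCube? o w) L
  ... | no w∉ = merged-outside L w d w∉
  ... | yes w∈ with find w∈
  ... | o , o∈L , (a , b , c , refl) with bit d a b c in bit≡
  ... | true  = trans (mergeAll-corner initial (cubes-allPairs-disjoint pms) o∈L a b c d)
                      (cong (fromMaybe _) (typeII-outward a b c d bit≡))
  ... | false = ⊥-elim (uncovered o∈L ((a , b , c , refl) , corner-move-inCube o a b c d bit≡))

  same-cube : ∀ {L} → IsPartialMergingSet L → ∀ {o o' w} → o ∈ L → o' ∈ L → InCube o w → InCube o' w → o ≡ o'
  same-cube pms o∈L o'∈L w∈o w∈o' with allPairs-∈ (cubes-allPairs-disjoint pms) o∈L o'∈L
  ... | inj₁ o≡o'         = o≡o'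
  ... | inj₂ (inj₁ o#o') = ⊥-elim (o#o' _ w∈o w∈o')
  ... | inj₂ (inj₂ o'#o) = ⊥-elim (o'#o _ w∈o' w∈o)

  -- Degrees

  degreeOf : Colour → (Dir → Colour) → (Dir → Colour) → ℕ
  degreeOf c F B = isC (F e₁) c + isC (F e₂) c + isC (F e₃) c + isC (B e₁) c + isC (B e₂) c + isC (B e₃) c

  degrees : (Dir → Colour) → (Dir → Colour) → ℕ × ℕ × ℕ
  degrees F B = degreeOf cX F B , degreeOf cY F B , degreeOf cZ F B

  degree≡2 : ∀ P v F B → (∀ d → P v d ≡ F d) → (∀ d → P (back v d) d ≡ B d) →
             degrees F B ≡ (2 , 2 , 2) → ∀ c → degree P c v ≡ 2
  degree≡2 P v F B F≡ B≡ eq c = trans (degreeOf-cong F≡ B≡) (component eq c)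
    where
    degreeOf-cong : ∀ {F F' B B'} → (∀ d → F d ≡ F' d) → (∀ d → B d ≡ B' d) → degreeOf c F B ≡ degreeOf c F' B'
    degreeOf-cong f b rewrite f e₁ | f e₂ | f e₃ | b e₁ | b e₂ | b e₃ = refl
    component : degrees F B ≡ (2 , 2 , 2) → ∀ c → degreeOf c F B ≡ 2
    component eq cX = cong proj₁ eq
    component eq cY = cong (proj₁ ∘ proj₂) eq
    component eq cZ = cong (proj₂ ∘ proj₂) eq

  initial-degrees : ∀ s s' → (s ≡ true → s' ≡ false) → degrees (initialColour s) (initialColour s') ≡ (2 , 2 , 2)
  initial-degrees true  false _ = refl
  initial-degrees false true  _ = refl
  initial-degrees false false _ = refl
  initial-degrees true  true  h with h refl
  ... | ()

  degree-initial : ∀ c v → degree initial c v ≡ 2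
  degree-initial c v = degree≡2 initial v _ _ (initial≡initialColour v) (initial-back v)
                         (initial-degrees _ _ (special⇒back-nonspecial v)) c

  -- the colour of the edge entering the corner abc in direction d
  backColour : Bool → Bool → Bool → Dir → Colour
  backColour a b c d with bit d a b c | setBit d false a b c
  ... | true  | a' , b' , c' = cubeColour a' b' c' d
  ... | false | _            = initialColour (weight a b c ≡ᵇ 1) d

  cube-degrees : ∀ a b c → degrees (cubeColour a b c) (backColour a b c) ≡ (2 , 2 , 2)
  cube-degrees false false false = refl
  cube-degrees false false true  = refl
  cube-degrees false true  false = refl
  cube-degrees false true  true  = refl
  cube-degrees true  false false = refl
  cube-degrees true  false true  = refl
  cube-degrees true  true  false = refl
  cube-degrees true  true  true  = refl

  degree-merged : ∀ {L} → IsPartialMergingSet L → ∀ col v → degree (merged L) col v ≡ 2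
  degree-merged {L} pms col v with Any.any? (λ o → inCube? o v) L
  ... | no v∉ = degree≡2 (merged L) v _ _ (λ d → trans (merged-outside L v d v∉) (initial≡initialColour v d))
                  back≡ (initial-degrees _ _ (special⇒back-nonspecial v)) col
    where
    back≡ : ∀ d → merged L (back v d) d ≡ initialColour (isSpecial (back v e₁)) d
    back≡ d = trans (merged-uncovered pms (back v d) d
                       (λ o∈L (_ , v∈o) → v∉ (lose o∈L (subst (InCube _) (move-back v d) v∈o))))
                    (initial-back v d)
  ... | yes v∈ with find v∈
  ... | o , o∈L , (a , b , c , refl) =
    degree≡2 (merged L) _ _ _ (merged-corner pms o∈L a b c) back≡ (cube-degrees a b c) col
    where
    back≡ : ∀ d → merged L (back (corner o a b c) d) d ≡ backColour a b c d
    back≡ d with bit d a b c in bit≡ | setBit d false a b c in set≡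
    ... | true | a' , b' , c' =
      trans (cong (λ w → merged L w d) (trans (corner-back o a b c d bit≡) (cong (corner′ o) set≡)))
            (merged-corner pms o∈L a' b' c' d)
    ... | false | _ =
      trans (merged-uncovered pms _ d uncovered)
            (trans (initial≡initialColour _ d)
                   (cong (λ s → initialColour s d) (isSpecial-back-corner (All.lookup (proj₁ pms) o∈L) a b c d)))
      where
      uncovered : ∀ {o'} → o' ∈ L → ¬ EdgeInCube o' (back (corner o a b c) d) d
      uncovered o'∈L ((a' , b' , c' , eq) , moved∈o')
        with same-cube pms o∈L o'∈L (a , b , c , refl) (subst (InCube _) (move-back _ d) moved∈o')
      ... | refl = back-corner-outside o a b c d bit≡ a' b' c' (sym eq)

  -- The snake

  module _ {P : Partition} {c : Colour} where

    path-trans : ∀ {u v w} → Path P c u v → Path P c v w → Path P c u w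
    path-trans here        q = q
    path-trans (fwd d e p) q = fwd d e (path-trans p q)
    path-trans (bwd d e p) q = bwd d e (path-trans p q)

    path-sym : ∀ {u v} → Path P c u v → Path P c v u
    path-sym here        = here
    path-sym (fwd d e p) = path-trans (path-sym p) (bwd d e here)
    path-sym (bwd d e p) = path-trans (path-sym p) (fwd d e here)

    edge : ∀ {w v} d → P w d ≡ c → move w d ≡ v → Path P c w v
    edge d e refl = fwd d e here

  snakeDir : Vertex → Dir
  snakeDir w = if isSpecial w then e₂ else e₁

  snake : Vertex → Vertex
  snake w = move w (snakeDir w)

  initial-snake : ∀ w → initial w (snakeDir w) ≡ cX
  initial-snake w = trans (initial≡initialColour w (snakeDir w)) (snake-colour (isSpecial w))
    where
    snake-colour : ∀ s → initialColour s (if s then e₂ else e₁) ≡ cX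
    snake-colour true  = refl
    snake-colour false = refl

  zc-snake : ∀ w → zc (snake w) ≡ zc w
  zc-snake w with isSpecial w
  ... | true  = refl
  ... | false = refl

  N² : ℕ
  N² = N * N

  instance
    N²-nonZero : NonZero N²
    N²-nonZero = m*n≢0 N N

  module Mod² = Congruence N²

  residue : Vertex → ℕ
  residue u = σ u % N

  residue<N : ∀ u → residue u < N
  residue<N u = m%n<n (σ u) N

  -- Along the snake, x increases until the coordinate sum reaches -1, then y increases;
  -- so (σ u mod N, y) numbers the layer in snake order.
  snakePos : Vertex → ℕ
  snakePos u = residue u + N * toℕ (yc u)

  snakePos<N² : ∀ u → snakePos u < N²
  snakePos<N² u = begin-strict
    residue u + N * toℕ (yc u)  <⟨ +-monoˡ-< (N * toℕ (yc u)) (residue<N u) ⟩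
    N + N * toℕ (yc u)          ≡⟨ *-suc N (toℕ (yc u)) ⟨
    N * suc (toℕ (yc u))        ≤⟨ *-monoʳ-≤ N (Finₚ.toℕ<n (yc u)) ⟩
    N²                          ∎
    where open ≤-Reasoning

  N*-%-≋² : ∀ a → N * (a % N) Mod².≋ N * a
  N*-%-≋² a = Mod².≋-trans (Mod².≋-sym (Mod².+*m-≋ (N * (a % N)) (a / N))) (Mod².≡⇒≋ (begin
    N * (a % N) + a / N * N²      ≡⟨ cong (N * (a % N) +_) (rearrange (a / N) N) ⟩
    N * (a % N) + N * (a / N * N) ≡⟨ *-distribˡ-+ N (a % N) (a / N * N) ⟨
    N * (a % N + a / N * N)       ≡⟨ cong (N *_) (m≡m%n+[m/n]*n a N) ⟨
    N * a                         ∎))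
    where
    open ≡-Reasoning
    rearrange : ∀ q m → q * (m * m) ≡ m * (q * m)
    rearrange = solve-∀

  residue-step : ∀ u → isSpecial u ≡ false → residue (move u e₁) ≡ suc (residue u)
  residue-step u nonspecial = ≋⇒≡ (residue<N (move u e₁)) suc-residue<N (begin
    σ (move u e₁) % N % N  ≡⟨ %-≋ (σ (move u e₁)) ⟩
    σ (move u e₁) % N      ≡⟨ σ-move u e₁ ⟩
    (σ u + 1) % N          ≡⟨ ≡⇒≋ (+-comm (σ u) 1) ⟩
    suc (σ u) % N          ≡⟨ +-congˡ-≋ 1 (%-≋ (σ u)) ⟨
    suc (residue u) % N    ∎)
    where
    open ≡-Reasoning
    suc-residue<N : suc (residue u) < N
    suc-residue<N with m≤n⇒m<n∨m≡n (residue<N u)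
    ... | inj₁ lt = lt
    ... | inj₂ eq with trans (sym (≋⇒special u (trans (cong (_∸ 1) eq) (sym N∸1%N)))) nonspecial
    ...   | ()

  residue-wraps : ∀ u → isSpecial u ≡ true → residue (move u e₂) ≡ 0
  residue-wraps u special = ≋⇒≡ (residue<N (move u e₂)) (<4⇒<N (s≤s z≤n)) (begin
    σ (move u e₂) % N % N  ≡⟨ %-≋ (σ (move u e₂)) ⟩
    σ (move u e₂) % N      ≡⟨ σ-move u e₂ ⟩
    (σ u + 1) % N          ≡⟨ +-congʳ-≋ 1 (special⇒≋ u special) ⟩
    (N ∸ 1 + 1) % N        ≡⟨ ≡⇒≋ N∸1+1≡N ⟩
    N % N                  ≡⟨ m≋0 ⟩
    0 % N                  ∎)
    where open ≡-Reasoning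

  snakePos-snake : ∀ u → snakePos (snake u) Mod².≋ suc (snakePos u)
  snakePos-snake u with isSpecial u in eq
  ... | false = Mod².≡⇒≋ (cong (_+ N * toℕ (yc u)) (residue-step u eq))
  ... | true = begin
    snakePos (move u e₂) % N²          ≡⟨ cong (λ t → (t + N * toℕ (addC (yc u) 1)) % N²) (residue-wraps u eq) ⟩
    (N * toℕ (addC (yc u) 1)) % N²     ≡⟨ cong (λ t → (N * t) % N²) (toℕ-addC (yc u) 1) ⟩
    (N * ((toℕ (yc u) + 1) % N)) % N²  ≡⟨ N*-%-≋² (toℕ (yc u) + 1) ⟩
    (N * (toℕ (yc u) + 1)) % N²        ≡⟨ cong (_% N²) next-row ⟩
    suc (snakePos u) % N²              ∎
    where
    open ≡-Reasoning
    next-row : N * (toℕ (yc u) + 1) ≡ suc (snakePos u)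
    next-row = begin
      N * (toℕ (yc u) + 1)          ≡⟨ cong (N *_) (+-comm (toℕ (yc u)) 1) ⟩
      N * suc (toℕ (yc u))          ≡⟨ *-suc N (toℕ (yc u)) ⟩
      N + N * toℕ (yc u)            ≡⟨ cong (_+ N * toℕ (yc u)) suc[N∸1]≡N ⟨
      suc (N ∸ 1 + N * toℕ (yc u))  ≡⟨ cong (λ t → suc (t + N * toℕ (yc u))) (trans (special⇒≋ u eq) N∸1%N) ⟨
      suc (snakePos u)              ∎

  suc[N²∸1]≡N² : suc (N² ∸ 1) ≡ N²
  suc[N²∸1]≡N² = m+[n∸m]≡n {1} (>-nonZero⁻¹ N²)

  N²∸1<N² : N² ∸ 1 < N²
  N²∸1<N² = subst (N² ∸ 1 <_) suc[N²∸1]≡N² ≤-refl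

  offset : Vertex → Vertex → ℕ
  offset r u = (snakePos u + (N² ∸ snakePos r)) % N²

  offset<N² : ∀ r u → offset r u < N²
  offset<N² r u = m%n<n _ N²

  offset≤N²∸1 : ∀ r u → offset r u ≤ N² ∸ 1
  offset≤N²∸1 r u = ≤-pred (subst (suc (offset r u) ≤_) (sym suc[N²∸1]≡N²) (offset<N² r u))

  offset-≋² : ∀ r u → offset r u + snakePos r Mod².≋ snakePos u
  offset-≋² r u = Mod².≋-trans (Mod².+-congʳ-≋ (snakePos r) (Mod².%-≋ (snakePos u + (N² ∸ snakePos r))))
    (Mod².≋-trans (Mod².≡⇒≋ (trans (+-assoc (snakePos u) _ (snakePos r))
                                   (cong (snakePos u +_) (m∸n+n≡m (<⇒≤ (snakePos<N² r))))))
                  (Mod².+m-≋ (snakePos u)))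

  offset≡ : ∀ r u k → snakePos u Mod².≋ snakePos r + k → k < N² → offset r u ≡ k
  offset≡ r u k pos≋ k<N² = Mod².≋⇒≡ (offset<N² r u) k<N² (Mod².+-cancelʳ-≋ (snakePos r)
    (Mod².≋-trans (offset-≋² r u) (Mod².≋-trans pos≋ (Mod².≡⇒≋ (+-comm (snakePos r) k)))))

  offset-self : ∀ r → offset r r ≡ 0
  offset-self r = offset≡ r r 0 (Mod².≡⇒≋ (sym (+-identityʳ (snakePos r)))) (>-nonZero⁻¹ N²)

  offset-snake : ∀ r u → suc (offset r u) < N² → offset r (snake u) ≡ suc (offset r u)
  offset-snake r u lt = Mod².≋⇒≡ (offset<N² r (snake u)) lt (Mod².+-cancelʳ-≋ (snakePos r) (begin
    (offset r (snake u) + snakePos r) % N²  ≡⟨ offset-≋² r (snake u) ⟩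
    snakePos (snake u) % N²                 ≡⟨ snakePos-snake u ⟩
    suc (snakePos u) % N²                   ≡⟨ Mod².+-congˡ-≋ 1 (offset-≋² r u) ⟨
    (suc (offset r u) + snakePos r) % N²    ∎))
    where open ≡-Reasoning

  offset-snake-self : ∀ u → offset (snake u) u ≡ N² ∸ 1
  offset-snake-self u = offset≡ (snake u) u (N² ∸ 1) (Mod².≋-sym (Mod².≋-trans
    (Mod².+-congʳ-≋ (N² ∸ 1) (snakePos-snake u))
    (Mod².≋-trans (Mod².≡⇒≋ (trans (sym (+-suc (snakePos u) (N² ∸ 1))) (cong (snakePos u +_) suc[N²∸1]≡N²)))
                  (Mod².+m-≋ (snakePos u))))) N²∸1<N²

  ≋²⇒≋ : ∀ {a b} → a Mod².≋ b → a ≋ b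
  ≋²⇒≋ {a} {b} eq = begin
    a % N         ≡⟨ m∣n⇒o%n%m≡o%m N N² a N∣N² ⟨
    a % N² % N    ≡⟨ cong (_% N) eq ⟩
    b % N² % N    ≡⟨ m∣n⇒o%n%m≡o%m N N² b N∣N² ⟩
    b % N         ∎
    where
    open ≡-Reasoning
    N∣N² : N ∣ N²
    N∣N² = divides N refl

  offset-residue : ∀ r u → offset r u + residue r ≋ residue u
  offset-residue r u = ≋-trans (+-congˡ-≋ (offset r u) (≋-sym (snakePos≋residue r)))
                               (≋-trans (≋²⇒≋ (offset-≋² r u)) (snakePos≋residue u))
    where
    snakePos≋residue : ∀ u → snakePos u ≋ residue u
    snakePos≋residue u = ≋-trans (≡⇒≋ (cong (residue u +_) (*-comm N (toℕ (yc u))))) (+*m-≋ (residue u) (toℕ (yc u)))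

  snakePos-injective : ∀ u v → snakePos u ≡ snakePos v → zc u ≡ zc v → u ≡ v
  snakePos-injective u@(x , y , z) v@(x' , y' , z') pos≡ refl = same-row y≡y'
    where
    residue≡ : residue u ≡ residue v
    residue≡ = ≋⇒≡ (residue<N u) (residue<N v) (begin
      residue u % N                 ≡⟨ +*m-≋ (residue u) (toℕ y) ⟨
      (residue u + toℕ y * N) % N   ≡⟨ ≡⇒≋ (trans (cong (residue u +_) (*-comm (toℕ y) N)) pos≡) ⟩
      (residue v + N * toℕ y') % N  ≡⟨ ≡⇒≋ (cong (residue v +_) (*-comm N (toℕ y'))) ⟩
      (residue v + toℕ y' * N) % N  ≡⟨ +*m-≋ (residue v) (toℕ y') ⟩
      residue v % N                 ∎)
      where open ≡-Reasoning
    y≡y' : y ≡ y'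
    y≡y' = Finₚ.toℕ-injective (*-cancelˡ-≡ (toℕ y) (toℕ y') N
             (+-cancelˡ-≡ (residue u) _ _ (trans pos≡ (cong (_+ N * toℕ y') (sym residue≡)))))
    same-row : y ≡ y' → u ≡ v
    same-row refl = cong (_, y , z) (toℕ-≋-injective (+-cancelʳ-≋ (toℕ y) (+-cancelʳ-≋ (toℕ z) residue≡)))

  offset-injective : ∀ r u v → offset r u ≡ offset r v → zc u ≡ zc v → u ≡ v
  offset-injective r u v off≡ = snakePos-injective u v (Mod².≋⇒≡ (snakePos<N² u) (snakePos<N² v)
    (Mod².≋-trans (Mod².≋-sym (offset-≋² r u)) (Mod².≋-trans (Mod².≡⇒≋ (cong (_+ snakePos r) off≡)) (offset-≋² r v))))

  module Arcs (Q : Partition) (i : Coord) (r : Vertex) where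

    Intact : ℕ → ℕ → Set
    Intact a b = ∀ w → zc w ≡ i → a ≤ offset r w → offset r w < b → Q w (snakeDir w) ≡ cX

    InArc : ℕ → ℕ → Vertex → Set
    InArc a b u = zc u ≡ i × a ≤ offset r u × offset r u ≤ b

    arc-path : ∀ t {u v} → zc u ≡ i → zc v ≡ i → offset r u + t ≡ offset r v →
               Intact (offset r u) (offset r v) → Path Q cX u v
    arc-path zero    {u} {v} zu zv eq _ =
      subst (Path Q cX u) (offset-injective r u v (trans (sym (+-identityʳ _)) eq) (trans zu (sym zv))) here
    arc-path (suc t) {u} {v} zu zv eq intact =
      fwd (snakeDir u) (intact u zu ≤-refl u<v)
          (arc-path t (trans (zc-snake u) zu) zv eq′
                    (λ w zw lo hi → intact w zw (≤-trans (n≤1+n _) (subst (_≤ offset r w) step lo)) hi))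
      where
      u<v : offset r u < offset r v
      u<v = subst (offset r u <_) eq (m<m+n (offset r u) (s≤s z≤n))
      step : offset r (snake u) ≡ suc (offset r u)
      step = offset-snake r u (≤-<-trans u<v (offset<N² r v))
      eq′ : offset r (snake u) + t ≡ offset r v
      eq′ = trans (cong (_+ t) step) (trans (sym (+-suc _ t)) eq)

    arc-connected : ∀ {a b u v} → Intact a b → InArc a b u → InArc a b v → Path Q cX u v
    arc-connected {a} {b} {u} {v} intact (zu , au , ub) (zv , av , vb) with ≤-total (offset r u) (offset r v)
    ... | inj₁ u≤v = arc-path _ zu zv (m+[n∸m]≡n u≤v)
                       (λ w zw lo hi → intact w zw (≤-trans au lo) (<-≤-trans hi vb))
    ... | inj₂ v≤u = path-sym (arc-path _ zv zu (m+[n∸m]≡n v≤u)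
                       (λ w zw lo hi → intact w zw (≤-trans av lo) (<-≤-trans hi ub)))

  residue-corner : ∀ {o} → SumCond o → ∀ a b c → residue (corner o a b c) ≡ predMod (weight a b c)
  residue-corner {o} sc a b c = ≋⇒≡ (residue<N (corner o a b c)) (predMod<N _ (weight≤3 a b c))
    (≋-trans (%-≋ (σ (corner o a b c))) (≋-trans (σ-corner sc a b c) (predMod-≋ (weight a b c))))

  snakePos-corner : ∀ {o} → SumCond o → ∀ a b c →
                    snakePos (corner o a b c) Mod².≋ predMod (weight a b c) + N * (toℕ (yc o) + count b)
  snakePos-corner {o} sc a b c = Mod².≋-trans
    (Mod².≡⇒≋ (cong₂ _+_ (residue-corner sc a b c) (cong (N *_) (toℕ-addC (yc o) (count b)))))
    (Mod².+-congˡ-≋ (predMod (weight a b c)) (N*-%-≋² (toℕ (yc o) + count b)))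

  N+1<N²∸1 : suc N < N² ∸ 1
  N+1<N²∸1 = ≤-trans (n≤1+n _) (∸-monoˡ-≤ 1 (begin
    4 + N      ≡⟨ +-comm 4 N ⟩
    N + 4      ≤⟨ +-monoʳ-≤ N (≤-trans 4≤N (m≤m+n N _)) ⟩
    4 * N      ≤⟨ *-monoˡ-≤ N 4≤N ⟩
    N²         ∎))
    where open ≤-Reasoning

  N<N²∸1 : N < N² ∸ 1
  N<N²∸1 = <-trans (n<1+n N) N+1<N²∸1

  module TopFace {o : Vertex} (sc : SumCond o) where

    private
      y : ℕ
      y = toℕ (yc o)

      r : Vertex
      r = corner o true false true

      pos-r : snakePos r Mod².≋ 1 + N * (y + 0)
      pos-r = snakePos-corner {o} sc true false true

      N*[y+1] : N * (y + 1) ≡ N * (y + 0) + N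
      N*[y+1] = distrib N y
        where
        distrib : ∀ N y → N * (y + 1) ≡ N * (y + 0) + N
        distrib = solve-∀

    offset-001 : offset r (corner o false false true) ≡ N² ∸ 1
    offset-001 = offset≡ r (corner o false false true) (N² ∸ 1) (begin
      snakePos (corner o false false true) % N²  ≡⟨ snakePos-corner {o} sc false false true ⟩
      (N * (y + 0)) % N²                         ≡⟨ Mod².+m-≋ (N * (y + 0)) ⟨
      (N * (y + 0) + N²) % N²                    ≡⟨ cong (λ t → (N * (y + 0) + t) % N²) suc[N²∸1]≡N² ⟨
      (N * (y + 0) + suc (N² ∸ 1)) % N²          ≡⟨ cong (_% N²) (+-suc (N * (y + 0)) (N² ∸ 1)) ⟩
      (1 + N * (y + 0) + (N² ∸ 1)) % N²          ≡⟨ Mod².+-congʳ-≋ (N² ∸ 1) pos-r ⟨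
      (snakePos r + (N² ∸ 1)) % N²               ∎) N²∸1<N²
      where open ≡-Reasoning

    offset-011 : offset r (corner o false true true) ≡ N
    offset-011 = offset≡ r (corner o false true true) N (begin
      snakePos (corner o false true true) % N²  ≡⟨ snakePos-corner {o} sc false true true ⟩
      (1 + N * (y + 1)) % N²                    ≡⟨ cong (λ t → suc t % N²) N*[y+1] ⟩
      (1 + N * (y + 0) + N) % N²                ≡⟨ Mod².+-congʳ-≋ N pos-r ⟨
      (snakePos r + N) % N²                     ∎) (<-trans N<N²∸1 N²∸1<N²)
      where open ≡-Reasoning

    offset-111 : offset r (corner o true true true) ≡ suc N
    offset-111 = offset≡ r (corner o true true true) (suc N) (begin
      snakePos (corner o true true true) % N²  ≡⟨ snakePos-corner {o} sc true true true ⟩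
      (2 + N * (y + 1)) % N²                   ≡⟨ cong (λ t → suc (suc t) % N²) N*[y+1] ⟩
      (2 + (N * (y + 0) + N)) % N²             ≡⟨ cong (λ t → suc t % N²) (+-suc (N * (y + 0)) N) ⟨
      (1 + N * (y + 0) + suc N) % N²           ≡⟨ Mod².+-congʳ-≋ (suc N) pos-r ⟨
      (snakePos r + suc N) % N²                ∎) (<-trans N+1<N²∸1 N²∸1<N²)
      where open ≡-Reasoning

  -- Applied to the offset x of a corner 000 from a corner 101 of another cube: their
  -- residues are -1 and 1, so x + 1 ≡ -1 (mod N).
  bottom-offset-avoids : ∀ x → x + 1 ≋ N ∸ 1 → x ≢ N × x ≢ suc N × x ≢ N² ∸ 1
  bottom-offset-avoids x x+1≋ = x≢N , x≢N+1 , x≢N²∸1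
    where
    small≉N∸1 : ∀ {k} → k < 3 → ¬ k ≋ N ∸ 1
    small≉N∸1 k<3 = ≢⇒≉ (<4⇒<N (≤-trans k<3 (n≤1+n 3))) N∸1<N (<⇒≢ (<-≤-trans k<3 3≤N∸1))
    N+≋ : ∀ k → N + k ≋ k
    N+≋ k = ≋-trans (≡⇒≋ (+-comm N k)) (+m-≋ k)
    x≢N : x ≢ N
    x≢N refl = small≉N∸1 (s≤s (s≤s z≤n)) (≋-trans (≋-sym (N+≋ 1)) x+1≋)
    x≢N+1 : x ≢ suc N
    x≢N+1 refl = small≉N∸1 (s≤s (s≤s (s≤s z≤n))) (≋-trans (≋-sym (≋-trans (≡⇒≋ (sym (+-suc N 1))) (N+≋ 2))) x+1≋)
    x≢N²∸1 : x ≢ N² ∸ 1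
    x≢N²∸1 refl = small≉N∸1 (s≤s z≤n) (begin
      0 % N                ≡⟨ m<n⇒m%n≡m (<4⇒<N (s≤s z≤n)) ⟩
      0                    ≡⟨ m*n%n≡0 N N ⟨
      N² % N               ≡⟨ cong (_% N) (trans (+-comm (N² ∸ 1) 1) suc[N²∸1]≡N²) ⟨
      (N² ∸ 1 + 1) % N     ≡⟨ x+1≋ ⟩
      (N ∸ 1) % N          ∎)
      where open ≡-Reasoning

  -- Layers linked by merged cubes

  Step : List Coord → Coord → Coord → Set
  Step Zs i j = i ∈ Zs × j ≡ addC i 1

  Linked : List Coord → Coord → Coord → Set
  Linked Zs = EqClosure (Step Zs)

  Linked-[] : ∀ {i j} → Linked [] i j → i ≡ j
  Linked-[] = EqClosure.fold isEquivalence λ ()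

  -- Reading the cycle of layers as the line z* + 1, …, z*, a step that avoids z and z*
  -- never crosses the gap between z and z + 1.
  module Gap (z* : Coord) where

    private
      K : ℕ
      K = N ∸ suc (toℕ z*)

      lin : Coord → ℕ
      lin i = (toℕ i + K) % N

      lin-z* : lin z* ≡ N ∸ 1
      lin-z* = trans (cong (_% N) (trans (cong (toℕ z* +_) (sym (∸-+-assoc N 1 (toℕ z*)))) (m+[n∸m]≡n z*≤N∸1))) N∸1%N
        where
        z*≤N∸1 : toℕ z* ≤ N ∸ 1
        z*≤N∸1 = ≤-pred (subst (suc (toℕ z*) ≤_) (sym suc[N∸1]≡N) (Finₚ.toℕ<n z*))

      lin-injective : ∀ {i j} → lin i ≡ lin j → i ≡ j
      lin-injective eq = toℕ-≋-injective (+-cancelʳ-≋ K (≋-trans (≋-sym (%-≋ _)) (≋-trans (≡⇒≋ eq) (%-≋ _))))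

      lin-suc : ∀ i → i ≢ z* → lin (addC i 1) ≡ suc (lin i)
      lin-suc i i≢z* = ≋⇒≡ (m%n<n _ N) suc-lin<N (begin
        (toℕ (addC i 1) + K) % N % N  ≡⟨ %-≋ _ ⟩
        (toℕ (addC i 1) + K) % N      ≡⟨ +-congʳ-≋ K (toℕ-addC-≋ i 1) ⟩
        (toℕ i + 1 + K) % N           ≡⟨ ≡⇒≋ (trans (+-assoc (toℕ i) 1 K) (+-suc (toℕ i) K)) ⟩
        suc (toℕ i + K) % N           ≡⟨ +-congˡ-≋ 1 (%-≋ (toℕ i + K)) ⟨
        suc (lin i) % N               ∎)
        where
        open ≡-Reasoning
        suc-lin<N : suc (lin i) < N
        suc-lin<N with m≤n⇒m<n∨m≡n (m%n<n (toℕ i + K) N)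
        ... | inj₁ lt = lt
        ... | inj₂ eq = ⊥-elim (i≢z* (lin-injective (trans (cong (_∸ 1) eq) (sym lin-z*))))

      below : Coord → Coord → Bool
      below z i = does (lin i ≤? lin z)

      ≤?-step : ∀ {a b} → a ≢ b → does (suc a ≤? b) ≡ does (a ≤? b)
      ≤?-step {a} {b} a≢b with a ≤? b
      ... | yes a≤b = trans (dec-true (suc a ≤? b) (≤∧≢⇒< a≤b a≢b)) (sym (dec-true (a ≤? b) a≤b))
      ... | no a≰b  = trans (dec-false (suc a ≤? b) (a≰b ∘ <⇒≤)) (sym (dec-false (a ≤? b) a≰b))

    not-linked : ∀ {Zs} z → z ∉ Zs → z* ∉ Zs → z ≢ z* → ¬ Linked Zs z (addC z 1)
    not-linked {Zs} z z∉ z*∉ z≢z* linked = case (begin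
      true                          ≡⟨ dec-true (lin z ≤? lin z) ≤-refl ⟨
      below z z                     ≡⟨ EqClosure.gfold isEquivalence (below z) step linked ⟩
      below z (addC z 1)            ≡⟨ cong (λ k → does (k ≤? lin z)) (lin-suc z z≢z*) ⟩
      does (suc (lin z) ≤? lin z)   ≡⟨ dec-false (suc (lin z) ≤? lin z) (<-irrefl refl) ⟩
      false                         ∎) of λ ()
      where
      open ≡-Reasoning
      step : ∀ {i j} → Step Zs i j → below z i ≡ below z j
      step {i} (i∈ , refl) = sym (trans (cong (λ k → does (k ≤? lin z)) (lin-suc i (λ { refl → z*∉ i∈ })))
                                        (≤?-step (λ eq → z∉ (subst (_∈ Zs) (lin-injective eq) i∈))))

    Classes : List Coord → ℕ → Set
    Classes Zs m = Σ (Coord → Fin m) λ f →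
      (∀ {i j} → f i ≡ f j → Linked Zs i j) × (∀ {i j} → Linked Zs i j → f i ≡ f j) × (∀ k → ∃ λ i → f i ≡ k)

    -- The new step joins two distinct classes, which identify then merges.
    extend-classes : ∀ {Zs m} z → z ∉ Zs → z* ∉ z ∷ Zs → Classes Zs (suc m) → Classes (z ∷ Zs) m
    extend-classes {Zs} z z∉ z*∉ (f , sound , complete , onto) =
      identify ∘ f , sound′ , EqClosure.gfold isEquivalence (identify ∘ f) step , onto′
      where
      α≢β : f z ≢ f (addC z 1)
      α≢β = not-linked z z∉ (z*∉ ∘ there) (λ { refl → z*∉ (here refl) }) ∘ sound
      open Identify (f z) (f (addC z 1)) α≢β
      new : Linked (z ∷ Zs) z (addC z 1)
      new = EqClosure.return (here refl , refl)
      old : ∀ {i j} → Linked Zs i j → Linked (z ∷ Zs) i j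
      old = EqClosure.map (λ (i∈ , eq) → there i∈ , eq)
      sound′ : ∀ {i j} → identify (f i) ≡ identify (f j) → Linked (z ∷ Zs) i j
      sound′ {i} {j} eq with identify-injective (f i) (f j) eq
      ... | inj₁ fi≡fj = old (sound fi≡fj)
      ... | inj₂ (inj₁ (fi≡β , fj≡α)) = EqClosure.transitive _ (old (sound fi≡β))
                                          (EqClosure.transitive _ (EqClosure.symmetric _ new) (old (sound (sym fj≡α))))
      ... | inj₂ (inj₂ (fi≡α , fj≡β)) = EqClosure.transitive _ (old (sound fi≡α))
                                          (EqClosure.transitive _ new (old (sound (sym fj≡β))))
      step : ∀ {i j} → Step (z ∷ Zs) i j → identify (f i) ≡ identify (f j)
      step (here refl , refl) = identify-αβ
      step (there i∈ , eq)   = cong identify (complete (EqClosure.return (i∈ , eq)))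
      onto′ : ∀ k → ∃ λ i → identify (f i) ≡ k
      onto′ k with identify-surjective k
      ... | j , eq with onto j
      ...   | i , refl = i , eq

    linked-classes : ∀ Zs → AllPairs _≢_ Zs → z* ∉ Zs → ∀ m → m + length Zs ≡ N → Classes Zs m
    linked-classes [] _ _ m m+0≡N rewrite trans (sym (+-identityʳ m)) m+0≡N =
      (λ i → i) , (λ eq → subst (Linked [] _) eq (EqClosure.reflexive (Step []))) , Linked-[] , λ k → k , refl
    linked-classes (z ∷ Zs) (z≢Zs ∷ distinct) z*∉ m eq =
      extend-classes z (λ z∈ → All.lookup z≢Zs z∈ refl) z*∉
        (linked-classes Zs distinct (z*∉ ∘ there) (suc m) (trans (sym (+-suc m (length Zs))) eq))

  -- Snake edges cut by merging

  data SnakeCut : Bool → Bool → Bool → Set where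
    cut000 : SnakeCut false false false
    cut001 : SnakeCut false false true
    cut011 : SnakeCut false true  true

  cube-snake : ∀ a b c → cubeColour a b c (if weight a b c ≡ᵇ 0 then e₂ else e₁) ≡ cX ⊎ SnakeCut a b c
  cube-snake false false false = inj₂ cut000
  cube-snake false false true  = inj₂ cut001
  cube-snake false true  false = inj₁ refl
  cube-snake false true  true  = inj₂ cut011
  cube-snake true  false false = inj₁ refl
  cube-snake true  false true  = inj₁ refl
  cube-snake true  true  false = inj₁ refl
  cube-snake true  true  true  = inj₁ refl

  cube-e₃-X : ∀ a b c → cubeColour a b c e₃ ≡ cX → c ≡ false
  cube-e₃-X _     _     false _ = refl
  cube-e₃-X false false true  ()
  cube-e₃-X false true  true  ()
  cube-e₃-X true  false true  ()
  cube-e₃-X true  true  true  ()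

  initialColour-e₃≢X : ∀ s → initialColour s e₃ ≢ cX
  initialColour-e₃≢X true  ()
  initialColour-e₃≢X false ()

  module Layers {L : List Vertex} (pms : IsPartialMergingSet L) where

    P : Partition
    P = merged L

    sumCond : ∀ {o} → o ∈ L → SumCond o
    sumCond = All.lookup (proj₁ pms)

    same-layer : ∀ {o o'} → o ∈ L → o' ∈ L → zc o ≡ zc o' → o ≡ o'
    same-layer o∈L o'∈L z≡ with allPairs-∈ (proj₂ pms) o∈L o'∈L
    ... | inj₁ o≡o'              = o≡o'
    ... | inj₂ (inj₁ (_ , _ , z≢)) = ⊥-elim (z≢ z≡)
    ... | inj₂ (inj₂ (_ , _ , z≢)) = ⊥-elim (z≢ (sym z≡))

    -- Merging removes a snake edge of layer i only at the corner 000 of a cube with bottom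
    -- face in layer i, or at the corners 001 and 011 of a cube with top face in layer i.
    BottomCut : Coord → Vertex → Set
    BottomCut i w = Σ Vertex λ o → o ∈ L × zc o ≡ i × corner o false false false ≡ w

    TopCut : Coord → Vertex → Set
    TopCut i w = Σ Vertex λ o → o ∈ L × addC (zc o) 1 ≡ i × (corner o false false true ≡ w ⊎ corner o false true true ≡ w)

    snake-intact : ∀ w → ¬ BottomCut (zc w) w → ¬ TopCut (zc w) w → P w (snakeDir w) ≡ cX
    snake-intact w ¬bottom ¬top with Any.any? (λ o → inCube? o w) L
    ... | no w∉ = trans (merged-outside L w (snakeDir w) w∉) (initial-snake w)
    ... | yes w∈ with find w∈
    ... | o , o∈L , (a , b , c , refl)
      with cube-snake a b c
         | trans (merged-corner pms o∈L a b c (snakeDir (corner o a b c)))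
                 (cong (λ s → cubeColour a b c (if s then e₂ else e₁)) (isSpecial-corner (sumCond o∈L) a b c))
    ... | inj₁ X     | eq = trans eq X
    ... | inj₂ cut000 | _ = ⊥-elim (¬bottom (o , o∈L , sym (addC-identityʳ (zc o)) , refl))
    ... | inj₂ cut001 | _ = ⊥-elim (¬top (o , o∈L , refl , inj₁ refl))
    ... | inj₂ cut011 | _ = ⊥-elim (¬top (o , o∈L , refl , inj₂ refl))

    NoBottom NoTop : Coord → Set
    NoBottom i = ∀ {o} → o ∈ L → zc o ≢ i
    NoTop    i = ∀ {o} → o ∈ L → addC (zc o) 1 ≢ i

    LayerConnected : Coord → Set
    LayerConnected i = ∀ u v → zc u ≡ i → zc v ≡ i → Path P cX u v

    bottomCut-at : ∀ {ob i w} → ob ∈ L → zc ob ≡ i → BottomCut i w → w ≡ corner ob false false false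
    bottomCut-at ob∈L zb (o , o∈L , zo , refl) with same-layer o∈L ob∈L (trans zo (sym zb))
    ... | refl = refl

    topCut-at : ∀ {ot i w} → ot ∈ L → addC (zc ot) 1 ≡ i → TopCut i w →
                w ≡ corner ot false false true ⊎ w ≡ corner ot false true true
    topCut-at ot∈L zt (o , o∈L , zo , at) with same-layer o∈L ot∈L (addC-cancelʳ 1 (trans zo (sym zt)))
    ... | refl = [ inj₁ ∘ sym , inj₂ ∘ sym ]′ at

    intact : ∀ {i} r {a b} →
             (∀ w → zc w ≡ i → a ≤ offset r w → offset r w < b → ¬ BottomCut i w × ¬ TopCut i w) →
             Arcs.Intact P i r a b
    intact r avoid w refl lo hi = let (¬bottom , ¬top) = avoid w refl lo hi in snake-intact w ¬bottom ¬top

    layer-none : ∀ {i} → NoBottom i → NoTop i → LayerConnected i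
    layer-none {i} nb nt u v zu zv =
      arc-connected (intact u λ _ _ _ _ → ¬bottom , ¬top) (zu , z≤n , offset≤N²∸1 u u) (zv , z≤n , offset≤N²∸1 u v)
      where
      open Arcs P i u
      ¬bottom : ∀ {w} → ¬ BottomCut i w
      ¬bottom (_ , o∈L , zo , _) = nb o∈L zo
      ¬top : ∀ {w} → ¬ TopCut i w
      ¬top (_ , o∈L , zo , _) = nt o∈L zo

    -- Cut once, the snake of layer i is a path from snake b round to b.
    layer-bottom : ∀ {ob i} → ob ∈ L → zc ob ≡ i → NoTop i → LayerConnected i
    layer-bottom {ob} {i} ob∈L zb nt u v zu zv =
      arc-connected (intact r avoid) (zu , z≤n , offset≤N²∸1 r u) (zv , z≤n , offset≤N²∸1 r v)
      where
      b r : Vertex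
      b = corner ob false false false
      r = snake b
      open Arcs P i r
      avoid : ∀ w → zc w ≡ i → 0 ≤ offset r w → offset r w < N² ∸ 1 → ¬ BottomCut i w × ¬ TopCut i w
      avoid w _ _ hi = (λ cut → <⇒≢ hi (trans (cong (offset r) (bottomCut-at ob∈L zb cut)) (offset-snake-self b)))
                     , (λ (_ , o∈L , zo , _) → nt o∈L zo)

    module _ {ot i} (ot∈L : ot ∈ L) (zt : addC (zc ot) 1 ≡ i) where

      open TopFace {ot} (sumCond ot∈L)

      private
        r q : Vertex
        r = corner ot true false true
        q = corner ot true true true

      open Arcs P i r

      -- the X-edge 101–111 of the merged cube joins the two arcs left by the top cuts
      chord : Path P cX r q
      chord = edge e₂ (merged-corner pms ot∈L true false true e₂) (corner-move ot true false true e₂ refl)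

      ¬topCut : ∀ {w} → offset r w ≢ N² ∸ 1 → offset r w ≢ N → ¬ TopCut i w
      ¬topCut ≢001 ≢011 cut with topCut-at ot∈L zt cut
      ... | inj₁ refl = ≢001 offset-001
      ... | inj₂ refl = ≢011 offset-011

      r∈[0,N] : InArc 0 N r
      r∈[0,N] = zt , z≤n , subst (_≤ N) (sym (offset-self r)) z≤n

      q∈[N+1,_] : ∀ {c} → suc N ≤ c → InArc (suc N) c q
      q∈[N+1, N+1≤c ] = zt , ≤-reflexive (sym offset-111) , subst (_≤ _) (sym offset-111) N+1≤c

      layer-top : NoBottom i → LayerConnected i
      layer-top nb u v zu zv = path-trans (to-r u zu) (path-sym (to-r v zv))
        where
        ¬bottom : ∀ {w} → ¬ BottomCut i w
        ¬bottom (_ , o∈L , zo , _) = nb o∈L zo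
        to-r : ∀ w → zc w ≡ i → Path P cX w r
        to-r w zw with offset r w ≤? N
        ... | yes ≤N = arc-connected (intact r (λ _ _ _ hi → ¬bottom , ¬topCut (<⇒≢ (<-trans hi N<N²∸1)) (<⇒≢ hi)))
                                     (zw , z≤n , ≤N) r∈[0,N]
        ... | no ≰N = path-trans (arc-connected (intact r (λ _ _ lo hi → ¬bottom , ¬topCut (<⇒≢ hi) (>⇒≢ lo)))
                                                (zw , ≰⇒> ≰N , offset≤N²∸1 r w) q∈[N+1, <⇒≤ N+1<N²∸1 ])
                                 (path-sym chord)

      module _ {ob} (ob∈L : ob ∈ L) (zb : zc ob ≡ i) where

        private
          b : Vertex
          b = corner ob false false false

          tb : ℕ
          tb = offset r b

          tb-avoids : tb ≢ N × tb ≢ suc N × tb ≢ N² ∸ 1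
          tb-avoids = bottom-offset-avoids tb (subst₂ (λ s s' → tb + s ≋ s')
            (residue-corner (sumCond ot∈L) true false true) (residue-corner (sumCond ob∈L) false false false)
            (offset-residue r b))

          offset-snake-b : offset r (snake b) ≡ suc tb
          offset-snake-b = offset-snake r b (≤∧≢⇒< (offset<N² r b) (proj₂ (proj₂ tb-avoids) ∘ cong (_∸ 1)))

          zc-b : zc b ≡ i
          zc-b = trans (addC-identityʳ (zc ob)) zb

          snake-b : snake b ≡ corner ob false true false
          snake-b = trans (cong (λ s → move b (if s then e₂ else e₁)) (isSpecial-corner (sumCond ob∈L) false false false))
                          (corner-move ob false false false e₂ refl)

          Free : ℕ → ℕ → Set
          Free a c = ∀ k → a ≤ k → k < c → k ≢ tb × k ≢ N × k ≢ N² ∸ 1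

          arc : ∀ {a c} → Free a c → Intact a c
          arc free = intact r λ w _ lo hi → let (≢tb , ≢N , ≢N²∸1) = free (offset r w) lo hi in
            (λ cut → ≢tb (cong (offset r) (bottomCut-at ob∈L zb cut))) , ¬topCut ≢N²∸1 ≢N

          b∈ : ∀ {a c} → a ≤ tb → tb ≤ c → InArc a c b
          b∈ a≤ ≤c = zc-b , a≤ , ≤c

          snake-b∈ : ∀ {a c} → a ≤ suc tb → suc tb ≤ c → InArc a c (snake b)
          snake-b∈ a≤ ≤c rewrite sym offset-snake-b = trans (zc-snake b) zc-b , a≤ , ≤c

        module _ (tb<N : tb < N) where

          private
            free₁ : Free 0 tb
            free₁ k _ hi = <⇒≢ hi , <⇒≢ (<-trans hi tb<N) , <⇒≢ (<-trans (<-trans hi tb<N) N<N²∸1)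

            free₂ : Free (suc tb) N
            free₂ k lo hi = >⇒≢ lo , <⇒≢ hi , <⇒≢ (<-trans hi N<N²∸1)

            free₃ : Free (suc N) (N² ∸ 1)
            free₃ k lo hi = >⇒≢ (<-trans tb<N lo) , >⇒≢ lo , <⇒≢ hi

          to-b-low : Path P cX b (snake b) → ∀ w → zc w ≡ i → Path P cX w b
          to-b-low bridge w zw with offset r w ≤? tb | offset r w ≤? N
          ... | yes ≤tb | _     = arc-connected (arc free₁) (zw , z≤n , ≤tb) (b∈ z≤n ≤-refl)
          ... | no ≰tb | yes ≤N = path-trans (arc-connected (arc free₂) (zw , ≰⇒> ≰tb , ≤N) (snake-b∈ ≤-refl tb<N))
                                             (path-sym bridge)
          ... | no _   | no ≰N  =
            path-trans (arc-connected (arc free₃) (zw , ≰⇒> ≰N , offset≤N²∸1 r w) q∈[N+1, <⇒≤ N+1<N²∸1 ])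
                       (path-trans (path-sym chord) (arc-connected (arc free₁) r∈[0,tb] (b∈ z≤n ≤-refl)))
            where
            r∈[0,tb] : InArc 0 tb r
            r∈[0,tb] = zt , z≤n , subst (_≤ tb) (sym (offset-self r)) z≤n

        module _ (N+1<tb : suc N < tb) where

          private
            free₁ : Free 0 N
            free₁ k _ hi = <⇒≢ (<-trans hi (<-trans (n<1+n N) N+1<tb)) , <⇒≢ hi , <⇒≢ (<-trans hi N<N²∸1)

            free₂ : Free (suc N) tb
            free₂ k lo hi = <⇒≢ hi , >⇒≢ lo , <⇒≢ (<-≤-trans hi (offset≤N²∸1 r b))

            free₃ : Free (suc tb) (N² ∸ 1)
            free₃ k lo hi = >⇒≢ lo , >⇒≢ (<-trans (<-trans (n<1+n N) N+1<tb) lo) , <⇒≢ hi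

          to-b-high : Path P cX b (snake b) → ∀ w → zc w ≡ i → Path P cX w b
          to-b-high bridge w zw with offset r w ≤? N | offset r w ≤? tb
          ... | yes ≤N | _      =
            path-trans (arc-connected (arc free₁) (zw , z≤n , ≤N) r∈[0,N])
                       (path-trans chord (arc-connected (arc free₂) q∈[N+1, <⇒≤ N+1<tb ] (b∈ (<⇒≤ N+1<tb) ≤-refl)))
          ... | no ≰N  | yes ≤tb = arc-connected (arc free₂) (zw , ≰⇒> ≰N , ≤tb) (b∈ (<⇒≤ N+1<tb) ≤-refl)
          ... | no _   | no ≰tb =
            path-trans (arc-connected (arc free₃) (zw , ≰⇒> ≰tb , offset≤N²∸1 r w)
                                      (snake-b∈ ≤-refl (subst (_≤ N² ∸ 1) offset-snake-b (offset≤N²∸1 r (snake b)))))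
                       (path-sym bridge)

        -- Layer i splits into at most three arcs; each reaches b directly, through the chord,
        -- or through the bridge b – 001 – (layer i+1) – 011 – snake b.
        layer-both : LayerConnected (addC i 1) → LayerConnected i
        layer-both above u v zu zv = path-trans (to-b u zu) (path-sym (to-b v zv))
          where
          bridge : Path P cX b (snake b)
          bridge = subst (Path P cX b) (sym snake-b) (path-trans
            (edge e₃ (merged-corner pms ob∈L false false false e₃) (corner-move ob false false false e₃ refl))
            (path-trans (above _ _ (cong (λ t → addC t 1) zb) (cong (λ t → addC t 1) zb))
                        (path-sym (edge e₃ (merged-corner pms ob∈L false true false e₃) (corner-move ob false true false e₃ refl)))))
          to-b : ∀ w → zc w ≡ i → Path P cX w b
          to-b with tb <? N
          ... | yes tb<N = to-b-low tb<N bridge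
          ... | no tb≮N  = to-b-high N+1<tb bridge
            where
            N+1<tb : suc N < tb
            N+1<tb = ≤∧≢⇒< (≤∧≢⇒< (≮⇒≥ tb≮N) (proj₁ tb-avoids ∘ sym)) (proj₁ (proj₂ tb-avoids) ∘ sym)

    layer-step : ∀ i → (∀ {ob} → ob ∈ L → zc ob ≡ i → LayerConnected (addC i 1)) → LayerConnected i
    layer-step i above with Any.any? (λ o → zc o Fin.≟ i) L | Any.any? (λ o → addC (zc o) 1 Fin.≟ i) L
    ... | no ¬bottom | no ¬top = layer-none (λ o∈L zo → ¬bottom (lose o∈L zo)) (λ o∈L zo → ¬top (lose o∈L zo))
    ... | no ¬bottom | yes top with find top
    ...   | ot , ot∈L , zt = layer-top ot∈L zt (λ o∈L zo → ¬bottom (lose o∈L zo))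
    layer-step i above | yes bottom | no ¬top with find bottom
    ...   | ob , ob∈L , zb = layer-bottom ob∈L zb (λ o∈L zo → ¬top (lose o∈L zo))
    layer-step i above | yes bottom | yes top with find bottom | find top
    ...   | ob , ob∈L , zb | ot , ot∈L , zt = layer-both ot∈L zt ob∈L zb (above ob∈L zb)

    -- Induct upwards from i to a layer z* that is the bottom of no cube.
    layers-connected : ∀ {z*} → NoBottom z* → ∀ i → LayerConnected i
    layers-connected {z*} nb* i = upwards (toℕ z* + (N ∸ toℕ i)) i (toℕ-≋-injective (begin
      toℕ (addC i (toℕ z* + (N ∸ toℕ i))) % N  ≡⟨ toℕ-addC-≋ i _ ⟩
      (toℕ i + (toℕ z* + (N ∸ toℕ i))) % N     ≡⟨ ≡⇒≋ (shuffle (toℕ i) (toℕ z*) (N ∸ toℕ i)) ⟩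
      (toℕ z* + (toℕ i + (N ∸ toℕ i))) % N     ≡⟨ ≡⇒≋ (cong (toℕ z* +_) (m+[n∸m]≡n (<⇒≤ (Finₚ.toℕ<n i)))) ⟩
      (toℕ z* + N) % N                         ≡⟨ +m-≋ (toℕ z*) ⟩
      toℕ z* % N                               ∎))
      where
      open ≡-Reasoning
      shuffle : ∀ a b c → a + (b + c) ≡ b + (a + c)
      shuffle = solve-∀
      upwards : ∀ d i → addC i d ≡ z* → LayerConnected i
      upwards zero    i eq = layer-step i λ ob∈L zb → ⊥-elim (nb* ob∈L (trans zb (trans (sym (addC-identityʳ i)) eq)))
      upwards (suc d) i eq = layer-step i (λ _ _ → upwards d (addC i 1) (trans (addC-assoc i 1 d) eq))

    X-e₃⇒bottom : ∀ w → P w e₃ ≡ cX → zc w ∈ map zc L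
    X-e₃⇒bottom w X with Any.any? (λ o → inCube? o w) L
    ... | no w∉ = ⊥-elim (initialColour-e₃≢X (isSpecial w)
                    (trans (sym (trans (merged-outside L w e₃ w∉) (initial≡initialColour w e₃))) X))
    ... | yes w∈ with find w∈
    ... | o , o∈L , (a , b , c , refl) with cube-e₃-X a b c (trans (sym (merged-corner pms o∈L a b c e₃)) X)
    ... | refl = subst (_∈ map zc L) (sym (addC-identityʳ (zc o))) (∈-map⁺ zc o∈L)

    path⇒linked : ∀ {u v} → Path P cX u v → Linked (map zc L) (zc u) (zc v)
    path⇒linked here                 = ε
    path⇒linked (fwd e₁ _ p)         = path⇒linked p
    path⇒linked (fwd e₂ _ p)         = path⇒linked p
    path⇒linked {w} (fwd e₃ X p)     = SymClosure.fwd (X-e₃⇒bottom w X , refl) ◅ path⇒linked p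
    path⇒linked (bwd e₁ _ p)         = path⇒linked p
    path⇒linked (bwd e₂ _ p)         = path⇒linked p
    path⇒linked (bwd {w} e₃ X p)     = SymClosure.bwd (X-e₃⇒bottom w X , refl) ◅ path⇒linked p

    module _ (short : length L < N) where

      private
        missing : ∃ λ z* → z* ∉ map zc L
        missing = length<⇒∃∉ (map zc L) (subst (_< N) (sym (length-map zc L)) short)

        z* = proj₁ missing
        z*∉ = proj₂ missing

        connected : ∀ i → LayerConnected i
        connected = layers-connected {z*} λ o∈L zo → z*∉ (subst (_∈ map zc L) zo (∈-map⁺ zc o∈L))

        LayerPath : Coord → Coord → Set
        LayerPath i j = ∀ u v → zc u ≡ i → zc v ≡ j → Path P cX u v

        layerPath-isEquivalence : IsEquivalence LayerPath
        layerPath-isEquivalence = record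
          { refl  = connected _
          ; sym   = λ p u v zu zv → path-sym (p v u zv zu)
          ; trans = λ {_} {j} p q u v zu zv → path-trans (p u (j , j , j) zu refl) (q (j , j , j) v refl zv)
          }

        step⇒path : ∀ {i j} → Step (map zc L) i j → LayerPath i j
        step⇒path (i∈ , refl) u v zu zv with ∈-map⁻ zc i∈
        ... | o , o∈L , refl = path-trans (connected _ u (corner o false false false) zu (addC-identityʳ (zc o)))
          (path-trans (edge e₃ (merged-corner pms o∈L false false false e₃) (corner-move o false false false e₃ refl))
                      (connected _ (corner o false false true) v refl zv))

      X-within-layer : ∀ u v → zc u ≡ zc v → Path P cX u v
      X-within-layer u v eq = connected (zc u) u v refl (sym eq)

      X-components : HasComponents P cX (N ∸ length L)
      X-components with Gap.linked-classes z* (map zc L) distinct z*∉ (N ∸ length L) sizes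
        where
        distinct : AllPairs _≢_ (map zc L)
        distinct = AllPairsₚ.map⁺ (AllPairs.map (proj₂ ∘ proj₂) (proj₂ pms))
        sizes : N ∸ length L + length (map zc L) ≡ N
        sizes = trans (cong (N ∸ length L +_) (length-map zc L)) (m∸n+n≡m (<⇒≤ short))
      ... | f , sound , complete , onto =
        f ∘ zc ,
        (λ _ _ p → complete (path⇒linked p)) ,
        (λ u v eq → EqClosure.fold layerPath-isEquivalence step⇒path (sound eq) u v refl refl) ,
        λ k → let (i , fi≡k) = onto k in (i , i , i) , λ { refl → fi≡k }

  -- Rotating the coordinates permutes the colours

  rotate unrotate : Vertex → Vertex
  rotate   (x , y , z) = (y , z , x)
  unrotate (x , y , z) = (z , x , y)

  rotateDir unrotateDir : Dir → Dir
  rotateDir e₁ = e₃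
  rotateDir e₂ = e₁
  rotateDir e₃ = e₂
  unrotateDir e₁ = e₂
  unrotateDir e₂ = e₃
  unrotateDir e₃ = e₁

  rotateColour : Colour → Colour
  rotateColour cX = cZ
  rotateColour cY = cX
  rotateColour cZ = cY

  rotateDir-unrotateDir : ∀ d → rotateDir (unrotateDir d) ≡ d
  rotateDir-unrotateDir e₁ = refl
  rotateDir-unrotateDir e₂ = refl
  rotateDir-unrotateDir e₃ = refl

  rotateColour-injective : ∀ {c c'} → rotateColour c ≡ rotateColour c' → c ≡ c'
  rotateColour-injective {cX} {cX} _ = refl
  rotateColour-injective {cY} {cY} _ = refl
  rotateColour-injective {cZ} {cZ} _ = refl

  rotate-move : ∀ w d → rotate (move w d) ≡ move (rotate w) (rotateDir d)
  rotate-move w e₁ = refl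
  rotate-move w e₂ = refl
  rotate-move w e₃ = refl

  unrotate-move : ∀ w d → unrotate (move w d) ≡ move (unrotate w) (unrotateDir d)
  unrotate-move w e₁ = refl
  unrotate-move w e₂ = refl
  unrotate-move w e₃ = refl

  σ-rotate : ∀ w → σ (rotate w) ≡ σ w
  σ-rotate (x , y , z) = shuffle (toℕ x) (toℕ y) (toℕ z)
    where
    shuffle : ∀ x y z → y + z + x ≡ x + y + z
    shuffle = solve-∀

  initial-rotate : ∀ w d → initial (rotate w) (rotateDir d) ≡ rotateColour (initial w d)
  initial-rotate w d = begin
    initial (rotate w) (rotateDir d)
      ≡⟨ initial≡initialColour (rotate w) (rotateDir d) ⟩
    initialColour (isSpecial (rotate w)) (rotateDir d)
      ≡⟨ cong (λ s → initialColour s (rotateDir d)) (isSpecial-cong (rotate w) w (≡⇒≋ (σ-rotate w))) ⟩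
    initialColour (isSpecial w) (rotateDir d)               ≡⟨ initialColour-rotate (isSpecial w) d ⟩
    rotateColour (initialColour (isSpecial w) d)            ≡⟨ cong rotateColour (initial≡initialColour w d) ⟨
    rotateColour (initial w d)                              ∎
    where
    open ≡-Reasoning
    initialColour-rotate : ∀ s d → initialColour s (rotateDir d) ≡ rotateColour (initialColour s d)
    initialColour-rotate true  e₁ = refl
    initialColour-rotate true  e₂ = refl
    initialColour-rotate true  e₃ = refl
    initialColour-rotate false e₁ = refl
    initialColour-rotate false e₂ = refl
    initialColour-rotate false e₃ = refl

  typeII-rotate : ∀ a b c d → typeII b c a (rotateDir d) ≡ Data.Maybe.map rotateColour (typeII a b c d)
  typeII-rotate false false false = λ { e₁ → refl ; e₂ → refl ; e₃ → refl }
  typeII-rotate false false true  = λ { e₁ → refl ; e₂ → refl ; e₃ → refl }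
  typeII-rotate false true  false = λ { e₁ → refl ; e₂ → refl ; e₃ → refl }
  typeII-rotate false true  true  = λ { e₁ → refl ; e₂ → refl ; e₃ → refl }
  typeII-rotate true  false false = λ { e₁ → refl ; e₂ → refl ; e₃ → refl }
  typeII-rotate true  false true  = λ { e₁ → refl ; e₂ → refl ; e₃ → refl }
  typeII-rotate true  true  false = λ { e₁ → refl ; e₂ → refl ; e₃ → refl }
  typeII-rotate true  true  true  = λ { e₁ → refl ; e₂ → refl ; e₃ → refl }

  Rotated : Partition → Partition → Set
  Rotated P Q = ∀ w d → Q (rotate w) (rotateDir d) ≡ rotateColour (P w d)

  merge-rotate : ∀ o {P Q} → Rotated P Q → Rotated (merge o P) (merge (rotate o) Q)
  merge-rotate o {P} {Q} P≈Q w d with inCube? o w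
  ... | yes (a , b , c , refl) = begin
    merge (rotate o) Q (corner (rotate o) b c a) (rotateDir d)
      ≡⟨ recolour-corner typeIIEdges (rotate o) Q b c a (rotateDir d) ⟩
    fromMaybe (Q (rotate (corner o a b c)) (rotateDir d)) (typeII b c a (rotateDir d))
      ≡⟨ cong₂ fromMaybe (P≈Q _ d) (typeII-rotate a b c d) ⟩
    fromMaybe (rotateColour (P _ d)) (Data.Maybe.map rotateColour (typeII a b c d))
      ≡⟨ fromMaybe-map (typeII a b c d) ⟩
    rotateColour (fromMaybe (P (corner o a b c) d) (typeII a b c d))
      ≡⟨ cong rotateColour (recolour-corner typeIIEdges o P a b c d) ⟨
    rotateColour (merge o P (corner o a b c) d)
      ∎
    where
    open ≡-Reasoning
    fromMaybe-map : ∀ {k} mk →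
                    fromMaybe (rotateColour k) (Data.Maybe.map rotateColour mk) ≡ rotateColour (fromMaybe k mk)
    fromMaybe-map (just _) = refl
    fromMaybe-map nothing  = refl
  ... | no w∉ = trans (recolour-outside typeIIEdges (rotate o) Q (rotate w) (rotateDir d)
                        (λ (a , b , c , eq) → w∉ (c , a , b , cong unrotate eq)))
                      (trans (P≈Q w d) (cong rotateColour (sym (recolour-outside typeIIEdges o P w d w∉))))

  mergeAll-rotate : ∀ L {P Q} → Rotated P Q → Rotated (mergeAll L P) (mergeAll (map rotate L) Q)
  mergeAll-rotate []      P≈Q = P≈Q
  mergeAll-rotate (o ∷ L) P≈Q = mergeAll-rotate L (merge-rotate o P≈Q)

  merged-rotate : ∀ L → Rotated (merged L) (merged (map rotate L))
  merged-rotate L = mergeAll-rotate L initial-rotate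

  module _ {P Q : Partition} (P≈Q : Rotated P Q) where

    rotate-path : ∀ {c u v} → Path P c u v → Path Q (rotateColour c) (rotate u) (rotate v)
    rotate-path here            = here
    rotate-path (fwd {w} d e p) =
      fwd (rotateDir d) (trans (P≈Q w d) (cong rotateColour e))
          (subst (λ t → Path Q _ t _) (rotate-move w d) (rotate-path p))
    rotate-path (bwd {w} d e p) =
      subst (λ t → Path Q _ t _) (sym (rotate-move w d))
            (bwd (rotateDir d) (trans (P≈Q w d) (cong rotateColour e)) (rotate-path p))

    unrotate-colour : ∀ {c} w d → Q w d ≡ rotateColour c → P (unrotate w) (unrotateDir d) ≡ c
    unrotate-colour w d e = rotateColour-injective
      (trans (sym (P≈Q (unrotate w) (unrotateDir d))) (trans (cong (Q w) (rotateDir-unrotateDir d)) e))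

    unrotate-path : ∀ {c u v} → Path Q (rotateColour c) u v → Path P c (unrotate u) (unrotate v)
    unrotate-path here            = here
    unrotate-path (fwd {w} d e p) =
      fwd (unrotateDir d) (unrotate-colour w d e) (subst (λ t → Path P _ t _) (unrotate-move w d) (unrotate-path p))
    unrotate-path (bwd {w} d e p) =
      subst (λ t → Path P _ t _) (sym (unrotate-move w d))
            (bwd (unrotateDir d) (unrotate-colour w d e) (unrotate-path p))

    rotate-components : ∀ {c k} → HasComponents Q (rotateColour c) k → HasComponents P c k
    rotate-components (f , sound , complete , onto) =
      f ∘ rotate , (λ _ _ p → sound _ _ (rotate-path p)) , (λ _ _ eq → unrotate-path (complete _ _ eq)) ,
      λ k → let (w , fw≡k) = onto k in unrotate w , λ { refl → fw≡k refl }

  rotate-partialMergingSet : ∀ {L} → IsPartialMergingSet L → IsPartialMergingSet (map rotate L)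
  rotate-partialMergingSet (scs , cds) =
    Allₚ.map⁺ (All.map (λ {o} sc → trans (cong (_% N) (σ-rotate o)) sc) scs) ,
    AllPairsₚ.map⁺ (AllPairs.map (λ (x≢ , y≢ , z≢) → y≢ , z≢ , x≢) cds)

  layerOf : Colour → Vertex → Coord
  layerOf cX = zc
  layerOf cY = xc
  layerOf cZ = yc

  LayerFacts : Partition → Colour → ℕ → Set
  LayerFacts P c k = (∀ u v → layerOf c u ≡ layerOf c v → Path P c u v) × HasComponents P c k

  layerOf-rotate : ∀ c u → layerOf (rotateColour c) (rotate u) ≡ layerOf c u
  layerOf-rotate cX u = refl
  layerOf-rotate cY u = refl
  layerOf-rotate cZ u = refl

  rotate-facts : ∀ {c L} → LayerFacts (merged (map rotate L)) (rotateColour c) (N ∸ length (map rotate L)) →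
                 LayerFacts (merged L) c (N ∸ length L)
  rotate-facts {c} {L} (within , components) rewrite length-map rotate L =
    (λ u v eq → unrotate-path (merged-rotate L)
                  (within (rotate u) (rotate v) (trans (layerOf-rotate c u) (trans eq (sym (layerOf-rotate c v)))))) ,
    rotate-components (merged-rotate L) components

  rotate-short : ∀ L → length L < N → length (map rotate L) < N
  rotate-short L = subst (_< N) (sym (length-map rotate L))

  X-facts : ∀ {L} → IsPartialMergingSet L → length L < N → LayerFacts (merged L) cX (N ∸ length L)
  X-facts pms short = Layers.X-within-layer pms short , Layers.X-components pms short

  Y-facts : ∀ {L} → IsPartialMergingSet L → length L < N → LayerFacts (merged L) cY (N ∸ length L)
  Y-facts {L} pms short = rotate-facts {cY} {L} (X-facts (rotate-partialMergingSet pms) (rotate-short L short))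

  Z-facts : ∀ {L} → IsPartialMergingSet L → length L < N → LayerFacts (merged L) cZ (N ∸ length L)
  Z-facts {L} pms short = rotate-facts {cZ} {L} (Y-facts (rotate-partialMergingSet pms) (rotate-short L short))

  initial-path⇒same-layer : ∀ c {u v} → Path initial c u v → layerOf c u ≡ layerOf c v
  initial-path⇒same-layer cX p = Linked-[] (Layers.path⇒linked ([] , []) p)
  initial-path⇒same-layer cY p = initial-path⇒same-layer cX (rotate-path initial-rotate p)
  initial-path⇒same-layer cZ p = initial-path⇒same-layer cX (rotate-path initial-rotate (rotate-path initial-rotate p))

  layer-facts : ∀ c {L} → IsPartialMergingSet L → length L < N → LayerFacts (merged L) c (N ∸ length L)
  layer-facts cX = X-facts
  layer-facts cY = Y-facts
  layer-facts cZ = Z-facts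

  initial-facts : ∀ c → LayerFacts initial c N
  initial-facts c = layer-facts c ([] , []) (<4⇒<N (s≤s z≤n))

  initial-layers : ∀ c u v → Path initial c u v ⇔ (layerOf c u ≡ layerOf c v)
  initial-layers c u v = mk⇔ (initial-path⇒same-layer c) (proj₁ (initial-facts c) u v)

  typeI-initial : ∀ {o} → SumCond o → TypeI initial o
  typeI-initial sc = All.map (λ {(ce a b c d _)} eq → trans (initial-corner sc a b c d) eq)
    (refl ∷ refl ∷ refl ∷ refl ∷ refl ∷ refl ∷ refl ∷ refl ∷ refl ∷ refl ∷ refl ∷ refl ∷ [])

  typeI-untouched : ∀ {L o} → SumCond o → All (λ o' → CubesDisjoint o' o) L → TypeI (merged L) o
  typeI-untouched {L} {o} sc disjoint =
    All.map (λ {(ce a b c d _)} eq → trans (merged-outside L _ d (untouched a b c)) eq) (typeI-initial sc)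
    where
    untouched : ∀ a b c → ¬ InSomeCube L (corner o a b c)
    untouched a b c w∈ with find w∈
    ... | o' , o'∈L , w∈o' = All.lookup disjoint o'∈L _ w∈o' (a , b , c , refl)

  module _ {S : List Vertex} (ms : IsMergingSet S) where

    private
      pms : IsPartialMergingSet S
      pms = proj₁ (proj₂ ms) , proj₂ (proj₂ ms)

      prefix-pms : ∀ k → IsPartialMergingSet (take k S)
      prefix-pms k = Allₚ.take⁺ k (proj₁ pms) , AllPairsₚ.take⁺ k (proj₂ pms)

      length-prefix : ∀ {k} → k ≤ length S → length (take k S) ≡ k
      length-prefix {k} k≤ = trans (length-take k S) (m≤n⇒m⊓n≡m k≤)

      prefix-short : ∀ {k} → k ≤ length S → length (take k S) < N
      prefix-short k≤ = subst (_< N) (sym (length-prefix k≤)) (≤-<-trans (subst (_ ≤_) (proj₁ ms) k≤) N∸1<N)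

    cubes-pairwise-disjoint : ∀ i j → i ≢ j → CubesDisjoint (lookup S i) (lookup S j)
    cubes-pairwise-disjoint i j i≢j w w∈i w∈j with allPairs-lookup (cubes-allPairs-disjoint pms) i j i≢j
    ... | inj₁ i#j = i#j w w∈i w∈j
    ... | inj₂ j#i = j#i w w∈j w∈i

    typeI-when-merged : ∀ i → TypeI (stateAfter S (toℕ i)) (lookup S i)
    typeI-when-merged i = typeI-untouched (All.lookup (proj₁ pms) (∈-lookup i))
                                          (allPairs-take-lookup (cubes-allPairs-disjoint pms) i)

    prefix-facts : ∀ c {k} → k ≤ length S → LayerFacts (stateAfter S k) c (N ∸ k)
    prefix-facts c {k} k≤ = subst (λ m → LayerFacts (stateAfter S k) c (N ∸ m)) (length-prefix k≤)
                                  (layer-facts c (prefix-pms k) (prefix-short k≤))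

    hamilton : HamiltonDecomposition (stateAfter S (length S))
    hamilton = cycle cX , cycle cY , cycle cZ
      where
      cycle : ∀ c → HamiltonCycle (stateAfter S (length S)) c
      cycle c = subst (HasComponents _ c) N∸[N∸1]≡1 (proj₂ (prefix-facts c ≤-refl)) ,
                degree-merged (prefix-pms (length S)) c
        where
        N∸[N∸1]≡1 : N ∸ length S ≡ 1
        N∸[N∸1]≡1 = trans (cong (N ∸_) (proj₁ ms)) (m∸[m∸n]≡n (<4⇒<N (s≤s z≤n)))

lemma4 : (n : ℕ) → 1 ≤ n → let open G n in
  (S : List Vertex) → IsMergingSet S →
    -- (1) the initial partition: components of X are the Z_i, of Y the X_i, of Z the Y_i,
    --     each colour has exactly 4ⁿ components, and each component is a cycle (2-regular)
    ( ((u v : Vertex) → Path initial cX u v ⇔ (zc u ≡ zc v))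
    × ((u v : Vertex) → Path initial cY u v ⇔ (xc u ≡ xc v))
    × ((u v : Vertex) → Path initial cZ u v ⇔ (yc u ≡ yc v))
    × HasComponents initial cX N
    × HasComponents initial cY N
    × HasComponents initial cZ N
    × ((c : Colour) (v : Vertex) → degree initial c v ≡ 2) )
    -- (iii) every cube with origin in S is of type I
    × ((v : Vertex) → v ∈ S → TypeI initial v)
    -- (2) cubes with origins in S are pairwise vertex-disjoint
    × ((i j : Fin (length S)) → i ≢ j → (w : Vertex) →
         InCube (lookup S i) w → ¬ InCube (lookup S j) w)
    -- (3) throughout the merging: each cube is of type I when it is merged,
    --     the Z_i / X_i / Y_i stay inside one component of X / Y / Z,
    --     and after k merges each colour has exactly 4ⁿ - k components
    × ((i : Fin (length S)) → TypeI (stateAfter S (toℕ i)) (lookup S i))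
    × ((k : ℕ) → k ≤ length S →
         ((u v : Vertex) → zc u ≡ zc v → Path (stateAfter S k) cX u v)
       × ((u v : Vertex) → xc u ≡ xc v → Path (stateAfter S k) cY u v)
       × ((u v : Vertex) → yc u ≡ yc v → Path (stateAfter S k) cZ u v)
       × HasComponents (stateAfter S k) cX (N ∸ k)
       × HasComponents (stateAfter S k) cY (N ∸ k)
       × HasComponents (stateAfter S k) cZ (N ∸ k))
    -- finally: {X, Y, Z} is a Hamilton decomposition of G_{n,3}
    × HamiltonDecomposition (stateAfter S (length S))
lemma4 n 1≤n S ms@(_ , sums , _) =
  ( initial-layers cX , initial-layers cY , initial-layers cZ
  , proj₂ (initial-facts cX) , proj₂ (initial-facts cY) , proj₂ (initial-facts cZ)
  , degree-initial )
  , (λ v v∈S → typeI-initial (All.lookup sums v∈S))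
  , cubes-pairwise-disjoint ms
  , typeI-when-merged ms
  , (λ k k≤ → proj₁ (prefix-facts ms cX k≤) , proj₁ (prefix-facts ms cY k≤) , proj₁ (prefix-facts ms cZ k≤)
            , proj₂ (prefix-facts ms cX k≤) , proj₂ (prefix-facts ms cY k≤) , proj₂ (prefix-facts ms cZ k≤))
  , hamilton ms
  where
  open G n
  open Grid n 1≤n
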